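{- For every prime $p>3$, $$\sum_{k=1}^{p-1}\binom{p-1}{k}\binom{p-1}{k-1}^2 \equiv 2^{p-1}-2^{2p-2} \pmod{p^3}.$$ -}

module Defs where

open import Data.Nat using (ℕ; zero; suc; _+_; _*_; _∸_; _^_)
open import Data.Nat.Combinatorics using (_C_)

sumFrom1 : ℕ → (ℕ → ℕ) → ℕ
sumFrom1 zero    f = 0
sumFrom1 (suc n) f = sumFrom1 n f + f (suc n)

lhsSum : ℕ → ℕ
lhsSum p = sumFrom1 (p ∸ 1) (λ k → ((p ∸ 1) C k) * (((p ∸ 1) C (k ∸ 1)) ^ 2))

module Submission where

-- For a prime p = 2m + 1 > 3, with n = p - 1:  Σ_{k=1}^{n} C(n,k) C(n,k-1)² ≡ 2^n - 2^{2n} (mod p³).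
--
-- Put x_k = C(n,k), y_k = C(n,k-1), u_k = x_k + y_k = C(p,k), e_k = (-1)^{k-1}, S = Σ x y²
-- and Y = Σ y³.  Each u_k is a multiple of p, e_k y_k ≡ 1 (mod p), and k ↦ p - k swaps x
-- with y and negates e.  Hence, modulo p³,
--   (1) Σ u³ = 2Y + 6S ≡ 0;   (2) Σ u y² = S + Y;   (3) u y² ≡ 2 e u y - u, as u (e y - 1)² ≡ 0;
--   (4) Σ e u y = Σ e y² = Σ_{j<n} (-1)^j C(n,j)² = (-1)^m C(2m,m) - 1, and Σ u = 2^p - 2.
-- So 4S = (1) - 2·(2) ≡ 4·2^n - 4(-1)^m C(2m,m), and Morley's congruence
-- (-1)^m C(2m,m) ≡ 4^n gives the claim.  Morley follows from Wolstenholme's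
-- C(2p-1,p-1) ≡ 1 by comparing products of odd and even numbers; both rest on the
-- expansion Π (a_j + p² c) ≡ Π a_j + p² c Σ_i Π_{j≠i} a_j together with Σ_{i≤m} (m!/i)² ≡ 0 (mod p).

open import Defs
open import Data.Nat as ℕ using (ℕ; zero; suc; z≤n; s≤s; _≤_; _<_; _>_; _∸_; pred)
import Data.Nat.Properties as ℕP
import Data.Nat.Divisibility as ND
import Data.Nat.Tactic.RingSolver as ℕSolver
open import Data.Nat.Combinatorics using (_C_; nCk+nC[k+1]≡[n+1]C[k+1]; k>n⇒nCk≡0; nCk≡nC[n∸k]; nCn≡1; nC1≡n)
open import Data.Nat.Primality using (Prime; prime⇒nonZero; prime⇒nonTrivial; prime⇒irreducible; euclidsLemma)
open import Data.Integer using (ℤ; +_; _+_; _*_; _-_; -_; 0ℤ; 1ℤ; _^_; ∣_∣)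
import Data.Integer.Properties as ℤP
open import Data.Integer.Divisibility.Signed
open import Data.Integer.Divisibility using () renaming (_∣_ to _∣ᵤ_)
open import Data.Integer.Tactic.RingSolver using (solve-∀)
open import Data.Empty using (⊥; ⊥-elim)
open import Data.Product using (∃; _,_)
open import Data.Sum using (_⊎_; inj₁; inj₂; [_,_]′)
open import Function using (id; _∘_)
open import Relation.Nullary using (¬_; yes; no; contradiction)
open import Relation.Binary.PropositionalEquality
open import Relation.Binary.Bundles using (Setoid)
open import Relation.Binary.Structures using (IsEquivalence)
import Relation.Binary.Reasoning.Setoid as SetoidReasoning

-- Congruence of integers: a ≡ b mod n when n divides a - b.  A record rather than
-- a synonym, so that a and b stay inferable from the type.
infix 4 _≡_mod_
record _≡_mod_ (a b n : ℤ) : Set where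
  constructor modular
  field divides-difference : n ∣ a - b
open _≡_mod_ public

module _ {n : ℤ} where

  ≡-mod-reflexive : ∀ {a b} → a ≡ b → a ≡ b mod n
  ≡-mod-reflexive {a} refl = modular (divides 0ℤ (self-difference a n))
    where self-difference : ∀ a n → a - a ≡ 0ℤ * n
          self-difference = solve-∀

  ≡-mod-refl : ∀ {a} → a ≡ a mod n
  ≡-mod-refl = ≡-mod-reflexive refl

  ≡-mod-sym : ∀ {a b} → a ≡ b mod n → b ≡ a mod n
  ≡-mod-sym {a} {b} (modular d) = modular (subst (n ∣_) (swap a b) (∣m⇒∣-m d))
    where swap : ∀ a b → - (a - b) ≡ b - a
          swap = solve-∀

  ≡-mod-trans : ∀ {a b c} → a ≡ b mod n → b ≡ c mod n → a ≡ c mod n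
  ≡-mod-trans {a} {b} {c} (modular d) (modular e) =
    modular (subst (n ∣_) (telescope a b c) (∣m∣n⇒∣m+n d e))
    where telescope : ∀ a b c → (a - b) + (b - c) ≡ a - c
          telescope = solve-∀

  ≡-mod-isEquivalence : IsEquivalence (λ a b → a ≡ b mod n)
  ≡-mod-isEquivalence = record { refl = ≡-mod-refl ; sym = ≡-mod-sym ; trans = ≡-mod-trans }

  +-cong-mod : ∀ {a b c d} → a ≡ b mod n → c ≡ d mod n → a + c ≡ b + d mod n
  +-cong-mod {a} {b} {c} {d} (modular d₁) (modular d₂) =
    modular (subst (n ∣_) (regroup a b c d) (∣m∣n⇒∣m+n d₁ d₂))
    where regroup : ∀ a b c d → (a - b) + (c - d) ≡ (a + c) - (b + d)
          regroup = solve-∀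

  +-congˡ-mod : ∀ c {a b} → a ≡ b mod n → c + a ≡ c + b mod n
  +-congˡ-mod c = +-cong-mod (≡-mod-refl {c})

  +-congʳ-mod : ∀ c {a b} → a ≡ b mod n → a + c ≡ b + c mod n
  +-congʳ-mod c eq = +-cong-mod eq (≡-mod-refl {c})

  *-cong-mod : ∀ {a b c d} → a ≡ b mod n → c ≡ d mod n → a * c ≡ b * d mod n
  *-cong-mod {a} {b} {c} {d} (modular d₁) (modular d₂) =
    modular (subst (n ∣_) (regroup a b c d) (∣m∣n⇒∣m+n (∣m⇒∣m*n c d₁) (∣n⇒∣m*n b d₂)))
    where regroup : ∀ a b c d → (a - b) * c + b * (c - d) ≡ a * c - b * d
          regroup = solve-∀

  *-congˡ-mod : ∀ c {a b} → a ≡ b mod n → c * a ≡ c * b mod n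
  *-congˡ-mod c = *-cong-mod (≡-mod-refl {c})

  -‿cong-mod : ∀ {a b} → a ≡ b mod n → - a ≡ - b mod n
  -‿cong-mod {a} {b} (modular d) = modular (subst (n ∣_) (negate a b) (∣m⇒∣-m d))
    where negate : ∀ a b → - (a - b) ≡ - a - - b
          negate = solve-∀

  ∣⇒≡0-mod : ∀ {a} → n ∣ a → a ≡ 0ℤ mod n
  ∣⇒≡0-mod {a} d = modular (subst (n ∣_) (sym (ℤP.+-identityʳ a)) d)

  ≡0-mod⇒∣ : ∀ {a} → a ≡ 0ℤ mod n → n ∣ a
  ≡0-mod⇒∣ {a} (modular d) = subst (n ∣_) (ℤP.+-identityʳ a) d

  multiple≡0-mod : ∀ q → q * n ≡ 0ℤ mod n
  multiple≡0-mod q = ∣⇒≡0-mod (∣n⇒∣m*n q ∣-refl)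

*-mono-∣ : ∀ {a b c d} → a ∣ b → c ∣ d → a * c ∣ b * d
*-mono-∣ {b = b} {c} a∣b c∣d = ∣-trans (*-monoˡ-∣ c a∣b) (*-monoʳ-∣ b c∣d)

≡-mod-divisor : ∀ {m n a b} → m ∣ n → a ≡ b mod n → a ≡ b mod m
≡-mod-divisor m∣n (modular d) = modular (∣-trans m∣n d)

≡-mod-setoid : ℤ → Setoid _ _
≡-mod-setoid n = record { isEquivalence = ≡-mod-isEquivalence {n} }

module ≡-mod-Reasoning (n : ℤ) = SetoidReasoning (≡-mod-setoid n)

module IteratedOperation {A : Set} (_∙_ : A → A → A) (ε : A)
  (assoc : ∀ a b c → (a ∙ b) ∙ c ≡ a ∙ (b ∙ c))
  (comm : ∀ a b → a ∙ b ≡ b ∙ a)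
  (identityˡ : ∀ a → ε ∙ a ≡ a) where

  big : ℕ → (ℕ → A) → A
  big zero    f = ε
  big (suc n) f = big n f ∙ f (suc n)

  identityʳ : ∀ a → a ∙ ε ≡ a
  identityʳ a = trans (comm a ε) (identityˡ a)

  interchange : ∀ a b c d → (a ∙ b) ∙ (c ∙ d) ≡ (a ∙ c) ∙ (b ∙ d)
  interchange a b c d = begin
    (a ∙ b) ∙ (c ∙ d)  ≡⟨ assoc a b (c ∙ d) ⟩
    a ∙ (b ∙ (c ∙ d))  ≡⟨ cong (a ∙_) (sym (assoc b c d)) ⟩
    a ∙ ((b ∙ c) ∙ d)  ≡⟨ cong (λ x → a ∙ (x ∙ d)) (comm b c) ⟩
    a ∙ ((c ∙ b) ∙ d)  ≡⟨ cong (a ∙_) (assoc c b d) ⟩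
    a ∙ (c ∙ (b ∙ d))  ≡⟨ sym (assoc a c (b ∙ d)) ⟩
    (a ∙ c) ∙ (b ∙ d)  ∎
    where open ≡-Reasoning

  big-cong : ∀ n {f g} → (∀ i → 1 ≤ i → i ≤ n → f i ≡ g i) → big n f ≡ big n g
  big-cong zero    eq = refl
  big-cong (suc n) eq = cong₂ _∙_ (big-cong n (λ i 1≤i i≤n → eq i 1≤i (ℕP.m≤n⇒m≤1+n i≤n)))
                                  (eq (suc n) (s≤s z≤n) ℕP.≤-refl)

  big-ext : ∀ n {f g} → (∀ i → f i ≡ g i) → big n f ≡ big n g
  big-ext n eq = big-cong n (λ i _ _ → eq i)

  big-distrib : ∀ n f g → big n (λ i → f i ∙ g i) ≡ big n f ∙ big n g
  big-distrib zero    f g = sym (identityˡ ε)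
  big-distrib (suc n) f g = trans (cong (_∙ (f (suc n) ∙ g (suc n))) (big-distrib n f g))
                                  (interchange (big n f) (big n g) (f (suc n)) (g (suc n)))

  big-split : ∀ m k f → big (m ℕ.+ k) f ≡ big m f ∙ big k (λ i → f (m ℕ.+ i))
  big-split m zero    f = trans (cong (λ j → big j f) (ℕP.+-identityʳ m)) (sym (identityʳ (big m f)))
  big-split m (suc k) f = begin
    big (m ℕ.+ suc k) f                    ≡⟨ cong (λ j → big j f) (ℕP.+-suc m k) ⟩
    big (m ℕ.+ k) f ∙ f (suc (m ℕ.+ k))    ≡⟨ cong (_∙ f (suc (m ℕ.+ k))) (big-split m k f) ⟩
    (big m f ∙ rest) ∙ f (suc (m ℕ.+ k))   ≡⟨ assoc (big m f) rest _ ⟩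
    big m f ∙ (rest ∙ f (suc (m ℕ.+ k)))   ≡⟨ cong (λ j → big m f ∙ (rest ∙ f j)) (sym (ℕP.+-suc m k)) ⟩
    big m f ∙ big (suc k) (λ i → f (m ℕ.+ i)) ∎
    where open ≡-Reasoning
          rest = big k (λ i → f (m ℕ.+ i))

  big-peel : ∀ n f → big (suc n) f ≡ f 1 ∙ big n (λ i → f (suc i))
  big-peel n f = trans (big-split 1 n f) (cong (_∙ big n (λ i → f (suc i))) (identityˡ (f 1)))

  big-reverse : ∀ n f → big n f ≡ big n (λ i → f (suc n ∸ i))
  big-reverse zero    f = refl
  big-reverse (suc n) f = begin
    big (suc n) f                                    ≡⟨ big-peel n f ⟩
    f 1 ∙ big n (λ i → f (suc i))                    ≡⟨ comm _ _ ⟩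
    big n (λ i → f (suc i)) ∙ f 1                    ≡⟨ cong (_∙ f 1) (big-reverse n (λ i → f (suc i))) ⟩
    big n (λ i → f (suc (suc n ∸ i))) ∙ f 1          ≡⟨ cong₂ _∙_ (big-cong n shift) (cong f (sym (ℕP.m+n∸n≡m 1 n))) ⟩
    big n (λ i → f (suc (suc n) ∸ i)) ∙ f (suc n ∸ n) ∎
    where
      open ≡-Reasoning
      shift : ∀ i → 1 ≤ i → i ≤ n → f (suc (suc n ∸ i)) ≡ f (suc (suc n) ∸ i)
      shift i _ i≤n = cong f (sym (ℕP.+-∸-assoc 1 (ℕP.m≤n⇒m≤1+n i≤n)))

  big-pairs : ∀ m f → big (m ℕ.+ m) f ≡ big m (λ i → f i ∙ f (suc (m ℕ.+ m) ∸ i))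
  big-pairs m f = begin
    big (m ℕ.+ m) f                                                  ≡⟨ big-split m m f ⟩
    big m f ∙ big m (λ i → f (m ℕ.+ i))                              ≡⟨ cong (big m f ∙_) (big-reverse m _) ⟩
    big m f ∙ big m (λ i → f (m ℕ.+ (suc m ∸ i)))                    ≡⟨ cong (big m f ∙_) (big-cong m mirror) ⟩
    big m f ∙ big m (λ i → f (suc (m ℕ.+ m) ∸ i))                    ≡⟨ sym (big-distrib m f _) ⟩
    big m (λ i → f i ∙ f (suc (m ℕ.+ m) ∸ i))                        ∎
    where
      open ≡-Reasoning
      mirror : ∀ i → 1 ≤ i → i ≤ m → f (m ℕ.+ (suc m ∸ i)) ≡ f (suc (m ℕ.+ m) ∸ i)
      mirror i _ i≤m = cong f (trans (sym (ℕP.+-∸-assoc m (ℕP.m≤n⇒m≤1+n i≤m))) (cong (_∸ i) (ℕP.+-suc m m)))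

  big-odd-even : ∀ m f → big (m ℕ.+ m) f ≡ big m (λ i → f (pred (i ℕ.+ i)) ∙ f (i ℕ.+ i))
  big-odd-even zero    f = refl
  big-odd-even (suc m) f = begin
    big (suc m ℕ.+ suc m) f                    ≡⟨ cong (λ j → big j f) (ℕP.+-suc (suc m) m) ⟩
    (big 2m f ∙ f (suc 2m)) ∙ f (suc (suc 2m)) ≡⟨ assoc (big 2m f) _ _ ⟩
    big 2m f ∙ (f (suc 2m) ∙ f (suc (suc 2m)))
      ≡⟨ cong₂ _∙_ (big-odd-even m f) (cong (λ j → f (pred j) ∙ f j) (sym (ℕP.+-suc (suc m) m))) ⟩
    big (suc m) (λ i → f (pred (i ℕ.+ i)) ∙ f (i ℕ.+ i)) ∎
    where open ≡-Reasoning
          2m = m ℕ.+ m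

module Sum = IteratedOperation _+_ 0ℤ ℤP.+-assoc ℤP.+-comm ℤP.+-identityˡ
module Product = IteratedOperation _*_ 1ℤ ℤP.*-assoc ℤP.*-comm ℤP.*-identityˡ

Σ : ℕ → (ℕ → ℤ) → ℤ
Σ = Sum.big

Π : ℕ → (ℕ → ℤ) → ℤ
Π = Product.big

Σ₀ : ℕ → (ℕ → ℤ) → ℤ
Σ₀ k f = Σ (suc k) (λ j → f (j ∸ 1))

Σ₀-peel : ∀ k f → Σ₀ (suc k) f ≡ f 0 + Σ₀ k (λ j → f (suc j))
Σ₀-peel k f = trans (Sum.big-peel (suc k) _) (cong (λ s → f 0 + s) (Sum.big-cong (suc k) shift))
  where shift : ∀ j → 1 ≤ j → j ≤ suc k → f j ≡ f (suc (j ∸ 1))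
        shift (suc j) _ _ = refl

Σ₀-cong : ∀ k {f g} → (∀ j → j ≤ k → f j ≡ g j) → Σ₀ k f ≡ Σ₀ k g
Σ₀-cong k eq = Sum.big-cong (suc k) (λ i _ i≤k+1 → eq (i ∸ 1) (ℕP.∸-monoˡ-≤ 1 i≤k+1))

Σ-scale : ∀ n c f → Σ n (λ i → c * f i) ≡ c * Σ n f
Σ-scale zero    c f = sym (ℤP.*-zeroʳ c)
Σ-scale (suc n) c f = trans (cong (_+ c * f (suc n)) (Σ-scale n c f))
                            (sym (ℤP.*-distribˡ-+ c (Σ n f) (f (suc n))))

Σ-neg : ∀ n f → Σ n (λ i → - f i) ≡ - Σ n f
Σ-neg zero    f = refl
Σ-neg (suc n) f = trans (cong (_+ (- f (suc n))) (Σ-neg n f))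
                        (sym (ℤP.neg-distrib-+ (Σ n f) (f (suc n))))

Σ-zero : ∀ n → Σ n (λ _ → 0ℤ) ≡ 0ℤ
Σ-zero zero    = refl
Σ-zero (suc n) = cong (_+ 0ℤ) (Σ-zero n)

Π-const : ∀ n c → Π n (λ _ → c) ≡ c ^ n
Π-const zero    c = refl
Π-const (suc n) c = trans (cong (_* c) (Π-const n c)) (ℤP.*-comm (c ^ n) c)

Π-scale : ∀ n c f → Π n (λ i → c * f i) ≡ c ^ n * Π n f
Π-scale n c f = trans (Product.big-distrib n (λ _ → c) f) (cong (_* Π n f) (Π-const n c))

^-distribʳ-* : ∀ k a b → (a * b) ^ k ≡ a ^ k * b ^ k
^-distribʳ-* k a b = begin
  (a * b) ^ k                 ≡⟨ Π-const k (a * b) ⟨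
  Π k (λ _ → a * b)           ≡⟨ Product.big-distrib k (λ _ → a) (λ _ → b) ⟩
  Π k (λ _ → a) * Π k (λ _ → b) ≡⟨ cong₂ _*_ (Π-const k a) (Π-const k b) ⟩
  a ^ k * b ^ k               ∎
  where open ≡-Reasoning

module _ {M : ℤ} where

  Σ-cong-mod : ∀ n {f g} → (∀ i → 1 ≤ i → i ≤ n → f i ≡ g i mod M) → Σ n f ≡ Σ n g mod M
  Σ-cong-mod zero    eq = ≡-mod-refl
  Σ-cong-mod (suc n) eq = +-cong-mod (Σ-cong-mod n (λ i 1≤i i≤n → eq i 1≤i (ℕP.m≤n⇒m≤1+n i≤n)))
                                     (eq (suc n) (s≤s z≤n) ℕP.≤-refl)

  Σ-∣ : ∀ n {f} → (∀ i → 1 ≤ i → i ≤ n → M ∣ f i) → M ∣ Σ n f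
  Σ-∣ n div = ≡0-mod⇒∣ (subst (Σ n _ ≡_mod M) (Σ-zero n)
                               (Σ-cong-mod n (λ i 1≤i i≤n → ∣⇒≡0-mod (div i 1≤i i≤n))))

omit : ℕ → (ℕ → ℤ) → ℕ → ℤ
omit i f j with j ℕ.≟ i
... | yes _ = 1ℤ
... | no  _ = f j

omit-here : ∀ i f → omit i f i ≡ 1ℤ
omit-here i f with i ℕ.≟ i
... | yes _   = refl
... | no  i≢i = contradiction refl i≢i

omit-elsewhere : ∀ {i j} f → j ≢ i → omit i f j ≡ f j
omit-elsewhere {i} {j} f j≢i with j ℕ.≟ i
... | yes j≡i = contradiction j≡i j≢i
... | no  _   = refl

Π-without : ℕ → ℕ → (ℕ → ℤ) → ℤ
Π-without n i f = Π n (omit i f)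

Π-without-beyond : ∀ n i f → n < i → Π-without n i f ≡ Π n f
Π-without-beyond n i f n<i =
  Product.big-cong n (λ j _ j≤n → omit-elsewhere f (ℕP.<⇒≢ (ℕP.≤-<-trans j≤n n<i)))

Π-without-suc : ∀ n i f → i ≤ n → Π-without (suc n) i f ≡ Π-without n i f * f (suc n)
Π-without-suc n i f i≤n = cong (Π-without n i f *_) (omit-elsewhere f (λ n+1≡i → ℕP.<⇒≢ (s≤s i≤n) (sym n+1≡i)))

Π-without-last : ∀ n f → Π-without (suc n) (suc n) f ≡ Π n f
Π-without-last n f = begin
  Π-without n (suc n) f * omit (suc n) f (suc n) ≡⟨ cong (Π-without n (suc n) f *_) (omit-here (suc n) f) ⟩
  Π-without n (suc n) f * 1ℤ                     ≡⟨ ℤP.*-identityʳ (Π-without n (suc n) f) ⟩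
  Π-without n (suc n) f                          ≡⟨ Π-without-beyond n (suc n) f ℕP.≤-refl ⟩
  Π n f                                          ∎
  where open ≡-Reasoning

Π-without-restore : ∀ n i f → 1 ≤ i → i ≤ n → Π-without n i f * f i ≡ Π n f
Π-without-restore zero    i f 1≤i i≤0 with () ← ℕP.≤-trans 1≤i i≤0
Π-without-restore (suc n) i f 1≤i i≤n+1 with ℕP.m≤n⇒m<n∨m≡n i≤n+1
... | inj₂ refl = cong (_* f (suc n)) (Π-without-last n f)
... | inj₁ (s≤s i≤n) = begin
  Π-without (suc n) i f * f i          ≡⟨ cong (_* f i) (Π-without-suc n i f i≤n) ⟩
  Π-without n i f * f (suc n) * f i    ≡⟨ swap (Π-without n i f) (f (suc n)) (f i) ⟩
  Π-without n i f * f i * f (suc n)    ≡⟨ cong (_* f (suc n)) (Π-without-restore n i f 1≤i i≤n) ⟩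
  Π n f * f (suc n)                    ∎
  where open ≡-Reasoning
        swap : ∀ a b c → a * b * c ≡ a * c * b
        swap = solve-∀

-- The coefficient of c in Π (a_j + c b_j):  Σ_i b_i Π_{j≠i} a_j.
firstOrder : ℕ → (ℕ → ℤ) → (ℕ → ℤ) → ℤ
firstOrder n a b = Σ n (λ i → b i * Π-without n i a)

firstOrder-suc : ∀ n a b → firstOrder (suc n) a b ≡ firstOrder n a b * a (suc n) + Π n a * b (suc n)
firstOrder-suc n a b = cong₂ _+_ earlier last
  where
    rotate : ∀ x y z → x * (y * z) ≡ z * (x * y)
    rotate = solve-∀
    earlier : Σ n (λ i → b i * Π-without (suc n) i a) ≡ firstOrder n a b * a (suc n)
    earlier = begin
      Σ n (λ i → b i * Π-without (suc n) i a)         ≡⟨ Sum.big-cong n one-more-factor ⟩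
      Σ n (λ i → a (suc n) * (b i * Π-without n i a)) ≡⟨ Σ-scale n (a (suc n)) _ ⟩
      a (suc n) * firstOrder n a b                    ≡⟨ ℤP.*-comm (a (suc n)) _ ⟩
      firstOrder n a b * a (suc n)                    ∎
      where
        open ≡-Reasoning
        one-more-factor : ∀ i → 1 ≤ i → i ≤ n → b i * Π-without (suc n) i a ≡ a (suc n) * (b i * Π-without n i a)
        one-more-factor i _ i≤n = trans (cong (b i *_) (Π-without-suc n i a i≤n)) (rotate (b i) _ (a (suc n)))
    last : b (suc n) * Π-without (suc n) (suc n) a ≡ Π n a * b (suc n)
    last = trans (cong (b (suc n) *_) (Π-without-last n a)) (ℤP.*-comm (b (suc n)) (Π n a))

Π-expansion : ∀ n a b c → Π n (λ j → a j + c * b j) ≡ Π n a + c * firstOrder n a b mod c * c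
Π-expansion zero    a b c = ≡-mod-reflexive (no-correction c)
  where no-correction : ∀ c → 1ℤ ≡ 1ℤ + c * 0ℤ
        no-correction = solve-∀
Π-expansion (suc n) a b c = begin
  Π n (λ j → a j + c * b j) * (α + c * β) ≈⟨ *-cong-mod (Π-expansion n a b c) ≡-mod-refl ⟩
  (A + c * D) * (α + c * β)               ≡⟨ expand A D α β c ⟩
  A * α + c * (D * α + A * β) + D * β * (c * c) ≈⟨ +-congˡ-mod (A * α + c * (D * α + A * β)) (multiple≡0-mod (D * β)) ⟩
  A * α + c * (D * α + A * β) + 0ℤ        ≡⟨ ℤP.+-identityʳ _ ⟩
  A * α + c * (D * α + A * β)             ≡⟨ cong (λ x → A * α + c * x) (sym (firstOrder-suc n a b)) ⟩
  Π (suc n) a + c * firstOrder (suc n) a b ∎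
  where
    open ≡-mod-Reasoning (c * c)
    A = Π n a
    D = firstOrder n a b
    α = a (suc n)
    β = b (suc n)
    expand : ∀ A D α β c → (A + c * D) * (α + c * β) ≡ A * α + c * (D * α + A * β) + D * β * (c * c)
    expand = solve-∀

pos-cancel : ∀ a b c → a ℕ.+ b ≡ c → + a ≡ + c - + b
pos-cancel a b c refl = trans (add-sub (+ a) (+ b)) (cong (_- + b) (sym (ℤP.pos-+ a b)))
  where add-sub : ∀ x y → x ≡ x + y - y
        add-sub = solve-∀

pos-∸ : ∀ {m n} → n ≤ m → + (m ∸ n) ≡ + m - + n
pos-∸ {m} {n} n≤m = pos-cancel (m ∸ n) n m (ℕP.m∸n+n≡m n≤m)

pos-double : ∀ i → + (i ℕ.+ i) ≡ + 2 * + i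
pos-double i = trans (ℤP.pos-+ i i) (twice (+ i))
  where twice : ∀ x → x + x ≡ + 2 * x
        twice = solve-∀

binom : ℕ → ℕ → ℤ
binom n k = + (n C k)

shift : (ℕ → ℤ) → ℕ → ℤ
shift Y zero    = 0ℤ
shift Y (suc j) = Y j

nC0≡1 : ∀ n → n C 0 ≡ 1
nC0≡1 n = trans (cong (n C_) (sym (ℕP.n∸n≡0 n))) (trans (sym (nCk≡nC[n∸k] (ℕP.≤-refl {n}))) (nCn≡1 n))

pascal : ∀ n j → binom (suc n) j ≡ binom n j + shift (binom n) j
pascal n zero    = cong +_ (trans (nC0≡1 (suc n)) (sym (trans (ℕP.+-identityʳ (n C 0)) (nC0≡1 n))))
pascal n (suc j) = trans (cong +_ (sym (nCk+nC[k+1]≡[n+1]C[k+1] n j)))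
                         (trans (ℤP.pos-+ (n C j) (n C suc j)) (ℤP.+-comm (binom n j) (binom n (suc j))))

binom-beyond : ∀ n k → n < k → binom n k ≡ 0ℤ
binom-beyond n k n<k = cong +_ (k>n⇒nCk≡0 n<k)

binom-sym : ∀ n k → k ≤ n → binom n (n ∸ k) ≡ binom n k
binom-sym n k k≤n = cong +_ (sym (nCk≡nC[n∸k] k≤n))

absorption : ∀ n k → suc k ℕ.* (suc n C suc k) ≡ suc n ℕ.* (n C k)
absorption zero    zero    = refl
absorption zero    (suc k) = begin
  suc (suc k) ℕ.* (1 C suc (suc k)) ≡⟨ cong (suc (suc k) ℕ.*_) (k>n⇒nCk≡0 {1} {suc (suc k)} (s≤s (s≤s z≤n))) ⟩
  suc (suc k) ℕ.* 0                 ≡⟨ ℕP.*-zeroʳ (suc (suc k)) ⟩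
  0                                 ≡⟨ cong (1 ℕ.*_) (k>n⇒nCk≡0 {0} {suc k} (s≤s z≤n)) ⟨
  1 ℕ.* (0 C suc k)                 ∎
  where open ≡-Reasoning
absorption (suc n) zero    = begin
  1 ℕ.* (suc (suc n) C 1) ≡⟨ ℕP.*-identityˡ _ ⟩
  suc (suc n) C 1         ≡⟨ nC1≡n (suc (suc n)) ⟩
  suc (suc n)             ≡⟨ ℕP.*-identityʳ (suc (suc n)) ⟨
  suc (suc n) ℕ.* 1       ≡⟨ cong (suc (suc n) ℕ.*_) (nC0≡1 (suc n)) ⟨
  suc (suc n) ℕ.* (suc n C 0) ∎
  where open ≡-Reasoning
absorption (suc n) (suc k) = begin
  suc (suc k) ℕ.* (suc (suc n) C suc (suc k)) ≡⟨ cong (suc (suc k) ℕ.*_) (sym (nCk+nC[k+1]≡[n+1]C[k+1] (suc n) (suc k))) ⟩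
  suc (suc k) ℕ.* (A ℕ.+ B)                  ≡⟨ regroup (suc k) A B ⟩
  suc k ℕ.* A ℕ.+ A ℕ.+ suc (suc k) ℕ.* B    ≡⟨ cong₂ (λ x y → x ℕ.+ A ℕ.+ y) (absorption n k) (absorption n (suc k)) ⟩
  suc n ℕ.* a ℕ.+ A ℕ.+ suc n ℕ.* b          ≡⟨ collect (suc n) a b A ⟩
  suc n ℕ.* (a ℕ.+ b) ℕ.+ A                  ≡⟨ cong (λ x → suc n ℕ.* x ℕ.+ A) (nCk+nC[k+1]≡[n+1]C[k+1] n k) ⟩
  suc n ℕ.* A ℕ.+ A                          ≡⟨ ℕP.+-comm (suc n ℕ.* A) A ⟩
  suc (suc n) ℕ.* A                          ∎
  where
    open ≡-Reasoning
    A = suc n C suc k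
    B = suc n C suc (suc k)
    a = n C k
    b = n C suc k
    regroup : ∀ k A B → suc k ℕ.* (A ℕ.+ B) ≡ k ℕ.* A ℕ.+ A ℕ.+ suc k ℕ.* B
    regroup = ℕSolver.solve-∀
    collect : ∀ n a b A → n ℕ.* a ℕ.+ A ℕ.+ n ℕ.* b ≡ n ℕ.* (a ℕ.+ b) ℕ.+ A
    collect = ℕSolver.solve-∀

factorial : ℕ → ℤ
factorial k = Π k (λ j → + j)

binom-falling : ∀ N k → k ≤ N → binom N k * factorial k ≡ Π k (λ j → + (N ∸ k ℕ.+ j))
binom-falling N       zero    _         = trans (ℤP.*-identityʳ (binom N 0)) (cong +_ (nC0≡1 N))
binom-falling (suc N) (suc k) (s≤s k≤N) = begin
  binom (suc N) (suc k) * (factorial k * + suc k) ≡⟨ regroup (binom (suc N) (suc k)) (factorial k) (+ suc k) ⟩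
  (+ suc k * binom (suc N) (suc k)) * factorial k ≡⟨ cong (_* factorial k) (ℤP.pos-* (suc k) (suc N C suc k)) ⟨
  + (suc k ℕ.* (suc N C suc k)) * factorial k     ≡⟨ cong (λ x → + x * factorial k) (absorption N k) ⟩
  + (suc N ℕ.* (N C k)) * factorial k             ≡⟨ cong (_* factorial k) (ℤP.pos-* (suc N) (N C k)) ⟩
  (+ suc N * binom N k) * factorial k             ≡⟨ ℤP.*-assoc (+ suc N) (binom N k) (factorial k) ⟩
  + suc N * (binom N k * factorial k)             ≡⟨ cong (+ suc N *_) (binom-falling N k k≤N) ⟩
  + suc N * Π k (λ j → + (N ∸ k ℕ.+ j))           ≡⟨ ℤP.*-comm (+ suc N) _ ⟩
  Π k (λ j → + (N ∸ k ℕ.+ j)) * + suc N           ≡⟨ cong (λ x → Π k (λ j → + (N ∸ k ℕ.+ j)) * + x) top ⟨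
  Π k (λ j → + (N ∸ k ℕ.+ j)) * + (N ∸ k ℕ.+ suc k) ∎
  where
    open ≡-Reasoning
    regroup : ∀ a f s → a * (f * s) ≡ (s * a) * f
    regroup = solve-∀
    top : N ∸ k ℕ.+ suc k ≡ suc N
    top = trans (ℕP.+-suc (N ∸ k) k) (cong suc (ℕP.m∸n+n≡m k≤N))

-- N!/i, the product 1⋯N with the factor i omitted.
coFactorial : ℕ → ℕ → ℤ
coFactorial N i = Π-without N i (λ j → + j)

coFactorial-restore : ∀ N i → 1 ≤ i → i ≤ N → coFactorial N i * + i ≡ factorial N
coFactorial-restore N i = Π-without-restore N i (λ j → + j)

binomial-row-sum : ∀ N → Σ₀ N (binom N) ≡ (+ 2) ^ N
binomial-row-sum zero    = refl
binomial-row-sum (suc N) = begin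
  Σ₀ (suc N) (binom (suc N))                       ≡⟨ Σ₀-cong (suc N) (λ j _ → pascal N j) ⟩
  Σ₀ (suc N) (λ j → B j + shift B j)               ≡⟨ Sum.big-distrib (suc (suc N)) _ _ ⟩
  (Σ₀ N B + B (suc N)) + Σ₀ (suc N) (shift B)
    ≡⟨ cong₂ (λ x y → (Σ₀ N B + x) + y) (binom-beyond N (suc N) ℕP.≤-refl) (Σ₀-peel N (shift B)) ⟩
  (Σ₀ N B + 0ℤ) + (0ℤ + Σ₀ N B)
    ≡⟨ cong₂ (λ a b → (a + 0ℤ) + (0ℤ + b)) (binomial-row-sum N) (binomial-row-sum N) ⟩
  ((+ 2) ^ N + 0ℤ) + (0ℤ + (+ 2) ^ N)              ≡⟨ collect ((+ 2) ^ N) ⟩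
  (+ 2) ^ suc N                                    ∎
  where open ≡-Reasoning
        B = binom N
        collect : ∀ x → (x + 0ℤ) + (0ℤ + x) ≡ + 2 * x
        collect = solve-∀

sign : ℕ → ℤ
sign j = (- 1ℤ) ^ j

sign-suc : ∀ j → sign (suc j) ≡ - sign j
sign-suc j = ℤP.-1*i≡-i (sign j)

sign-+ : ∀ a b → sign (a ℕ.+ b) ≡ sign a * sign b
sign-+ = ℤP.^-distribˡ-+-* (- 1ℤ)

sign-square : ∀ j → sign j * sign j ≡ 1ℤ
sign-square j = trans (sym (^-distribʳ-* j (- 1ℤ) (- 1ℤ))) (ℤP.^-zeroˡ j)

-- The signed convolution  Σ_{j=0}^{k} (-1)^j X_j Y_{k-j}, i.e. the coefficient of t^k
-- in X(-t) Y(t).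
signedConvolution : (ℕ → ℤ) → (ℕ → ℤ) → ℕ → ℤ
signedConvolution X Y k = Σ₀ k (λ j → sign j * (X j * Y (k ∸ j)))

-- The alternating convolution  c(n,k) = Σ_{j=0}^{k} (-1)^j C(n,j) C(n,k-j),  the
-- coefficient of t^k in (1-t)^n (1+t)^n = (1-t²)^n.
alternating : ℕ → ℕ → ℤ
alternating n = signedConvolution (binom n) (binom n)

module AlternatingConvolution where

  vanishˡ : ∀ s {a} b → a ≡ 0ℤ → s * (a * b) ≡ 0ℤ
  vanishˡ s b refl = trans (cong (s *_) (ℤP.*-zeroˡ b)) (ℤP.*-zeroʳ s)

  vanishʳ : ∀ s a {b} → b ≡ 0ℤ → s * (a * b) ≡ 0ℤ
  vanishʳ s a refl = trans (cong (s *_) (ℤP.*-zeroʳ a)) (ℤP.*-zeroʳ s)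

  -- Multiplying Y(t) by t shifts the coefficients ...
  shiftʳ : ∀ X Y k → signedConvolution X (shift Y) (suc k) ≡ signedConvolution X Y k
  shiftʳ X Y k = begin
    Σ₀ k (λ j → sign j * (X j * shift Y (suc k ∸ j))) + sign (suc k) * (X (suc k) * shift Y (suc k ∸ suc k))
      ≡⟨ cong₂ _+_ (Σ₀-cong k (λ j j≤k → cong (λ i → sign j * (X j * shift Y i)) (ℕP.+-∸-assoc 1 j≤k)))
                   (vanishʳ (sign (suc k)) (X (suc k)) (cong (shift Y) (ℕP.n∸n≡0 k))) ⟩
    signedConvolution X Y k + 0ℤ
      ≡⟨ ℤP.+-identityʳ _ ⟩
    signedConvolution X Y k ∎
    where open ≡-Reasoning

  -- ... and multiplying X(-t) by t does the same up to a sign.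
  shiftˡ : ∀ X Y k → signedConvolution (shift X) Y (suc k) ≡ - signedConvolution X Y k
  shiftˡ X Y k = begin
    Σ₀ (suc k) (λ j → sign j * (shift X j * Y (suc k ∸ j))) ≡⟨ Σ₀-peel k (λ j → sign j * (shift X j * Y (suc k ∸ j))) ⟩
    0ℤ + Σ₀ k (λ j → sign (suc j) * (X j * Y (k ∸ j)))      ≡⟨ ℤP.+-identityˡ _ ⟩
    Σ₀ k (λ j → sign (suc j) * (X j * Y (k ∸ j)))           ≡⟨ Σ₀-cong k (λ j _ → flip (sign j) (X j) (Y (k ∸ j))) ⟩
    Σ₀ k (λ j → - (sign j * (X j * Y (k ∸ j))))
      ≡⟨ Σ-neg (suc k) (λ j → sign (j ∸ 1) * (X (j ∸ 1) * Y (k ∸ (j ∸ 1)))) ⟩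
    - signedConvolution X Y k                              ∎
    where open ≡-Reasoning
          flip : ∀ s a b → - 1ℤ * s * (a * b) ≡ - (s * (a * b))
          flip = solve-∀

  bilinear : ∀ X X′ Y Y′ k →
    signedConvolution (λ j → X j + X′ j) (λ j → Y j + Y′ j) k ≡
    signedConvolution X Y k + signedConvolution X Y′ k + signedConvolution X′ Y k + signedConvolution X′ Y′ k
  bilinear X X′ Y Y′ k = begin
    signedConvolution (λ j → X j + X′ j) (λ j → Y j + Y′ j) k
      ≡⟨ Σ₀-cong k (λ j _ → expand (X j) (X′ j) (Y (k ∸ j)) (Y′ (k ∸ j)) (sign j)) ⟩
    Σ₀ k (λ j → term X Y j + term X Y′ j + term X′ Y j + term X′ Y′ j)
      ≡⟨ Sum.big-distrib (suc k) _ _ ⟩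
    Σ₀ k (λ j → term X Y j + term X Y′ j + term X′ Y j) + signedConvolution X′ Y′ k
      ≡⟨ cong (_+ signedConvolution X′ Y′ k) (Sum.big-distrib (suc k) _ _) ⟩
    Σ₀ k (λ j → term X Y j + term X Y′ j) + signedConvolution X′ Y k + signedConvolution X′ Y′ k
      ≡⟨ cong (λ x → x + signedConvolution X′ Y k + signedConvolution X′ Y′ k) (Sum.big-distrib (suc k) _ _) ⟩
    signedConvolution X Y k + signedConvolution X Y′ k + signedConvolution X′ Y k + signedConvolution X′ Y′ k ∎
    where
      open ≡-Reasoning
      term : (ℕ → ℤ) → (ℕ → ℤ) → ℕ → ℤ
      term A B j = sign j * (A j * B (k ∸ j))
      expand : ∀ a b c d s → s * ((a + b) * (c + d)) ≡ s * (a * c) + s * (a * d) + s * (b * c) + s * (b * d)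
      expand = solve-∀

  -- c(n+1, k+2) = c(n, k+2) - c(n, k), from (1+t)^{n+1}(1-t)^{n+1} = (1-t²)(1+t)^n(1-t)^n.
  recurrence : ∀ n k → alternating (suc n) (suc (suc k)) ≡ alternating n (suc (suc k)) - alternating n k
  recurrence n k = begin
    alternating (suc n) (suc (suc k))
      ≡⟨ Σ₀-cong (suc (suc k)) (λ j _ → cong₂ (λ a b → sign j * (a * b)) (pascal n j) (pascal n (suc (suc k) ∸ j))) ⟩
    signedConvolution (λ j → B j + shift B j) (λ j → B j + shift B j) (suc (suc k))
      ≡⟨ bilinear B (shift B) B (shift B) (suc (suc k)) ⟩
    c₂ + signedConvolution B (shift B) (suc (suc k)) + signedConvolution (shift B) B (suc (suc k))
       + signedConvolution (shift B) (shift B) (suc (suc k))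
      ≡⟨ cong₂ (λ x y → c₂ + x + y + signedConvolution (shift B) (shift B) (suc (suc k))) (shiftʳ B B (suc k)) (shiftˡ B B (suc k)) ⟩
    c₂ + c₁ + - c₁ + signedConvolution (shift B) (shift B) (suc (suc k))
      ≡⟨ cong (λ x → c₂ + c₁ + - c₁ + x) (trans (shiftˡ B (shift B) (suc k)) (cong -_ (shiftʳ B B k))) ⟩
    c₂ + c₁ + - c₁ + - c₀
      ≡⟨ cancel c₂ c₁ c₀ ⟩
    c₂ - c₀ ∎
    where
      open ≡-Reasoning
      B = binom n
      c₀ = alternating n k
      c₁ = alternating n (suc k)
      c₂ = alternating n (suc (suc k))
      cancel : ∀ a b d → a + b + - b + - d ≡ a - d
      cancel = solve-∀

  at-one : ∀ n → alternating n 1 ≡ 0ℤ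
  at-one n = cancel (binom n 0) (binom n 1)
    where cancel : ∀ x y → 0ℤ + 1ℤ * (x * y) + (- 1ℤ) * 1ℤ * (y * x) ≡ 0ℤ
          cancel = solve-∀

  empty-row : ∀ k → alternating 0 (suc k) ≡ 0ℤ
  empty-row k = trans (Σ₀-cong (suc k) vanish) (Σ-zero (suc (suc k)))
    where
      vanish : ∀ j → j ≤ suc k → sign j * (binom 0 j * binom 0 (suc k ∸ j)) ≡ 0ℤ
      vanish zero    _ = vanishʳ 1ℤ (binom 0 0) (binom-beyond 0 (suc k) (s≤s z≤n))
      vanish (suc j) _ = vanishˡ (sign (suc j)) (binom 0 (suc k ∸ suc j)) (binom-beyond 0 (suc j) (s≤s z≤n))

  double-suc : ∀ i → suc i ℕ.+ suc i ≡ suc (suc (i ℕ.+ i))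
  double-suc i = ℕP.+-suc (suc i) i

  even : ∀ n i → alternating n (i ℕ.+ i) ≡ sign i * binom n i
  odd  : ∀ n i → alternating n (suc (i ℕ.+ i)) ≡ 0ℤ
  even zero    zero    = refl
  even zero    (suc i) = trans (empty-row (i ℕ.+ suc i))
                               (sym (trans (cong (sign (suc i) *_) (binom-beyond 0 (suc i) (s≤s z≤n)))
                                           (ℤP.*-zeroʳ (sign (suc i)))))
  even (suc n) zero    = refl
  even (suc n) (suc i) = begin
    alternating (suc n) (suc i ℕ.+ suc i)                  ≡⟨ cong (alternating (suc n)) (double-suc i) ⟩
    alternating (suc n) (suc (suc (i ℕ.+ i)))              ≡⟨ recurrence n (i ℕ.+ i) ⟩
    alternating n (suc (suc (i ℕ.+ i))) - alternating n (i ℕ.+ i)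
                                                           ≡⟨ cong₂ _-_ (trans (cong (alternating n) (sym (double-suc i))) (even n (suc i))) (even n i) ⟩
    sign (suc i) * binom n (suc i) - sign i * binom n i    ≡⟨ factor (sign i) (binom n (suc i)) (binom n i) ⟩
    sign (suc i) * (binom n (suc i) + binom n i)           ≡⟨ cong (sign (suc i) *_) (pascal n (suc i)) ⟨
    sign (suc i) * binom (suc n) (suc i)                   ∎
    where open ≡-Reasoning
          factor : ∀ s a b → (- 1ℤ * s) * a - s * b ≡ (- 1ℤ * s) * (a + b)
          factor = solve-∀
  odd zero    i       = empty-row (i ℕ.+ i)
  odd (suc n) zero    = at-one (suc n)
  odd (suc n) (suc i) = begin
    alternating (suc n) (suc (suc i ℕ.+ suc i))             ≡⟨ cong (alternating (suc n) ∘ suc) (double-suc i) ⟩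
    alternating (suc n) (suc (suc (suc (i ℕ.+ i))))         ≡⟨ recurrence n (suc (i ℕ.+ i)) ⟩
    alternating n (suc (suc (suc (i ℕ.+ i)))) - alternating n (suc (i ℕ.+ i))
                                                            ≡⟨ cong₂ _-_ (trans (cong (alternating n ∘ suc) (sym (double-suc i))) (odd n (suc i))) (odd n i) ⟩
    0ℤ - 0ℤ                                                 ≡⟨⟩
    0ℤ                                                      ∎
    where open ≡-Reasoning

module ModuloPrime {p : ℕ} (isPrime : Prime p) where

  P : ℤ
  P = + p

  instance
    p≢0 : ℕ.NonZero p
    p≢0 = prime⇒nonZero isPrime

  -- p³ as a product (x ^ 3 unfolds to x * (x * (x * 1))).
  cube-P : P * P * P ≡ P ^ 3
  cube-P = cube P
    where cube : ∀ x → x * x * x ≡ x * (x * (x * 1ℤ))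
          cube = solve-∀

  Unit : ℤ → Set
  Unit c = ¬ (P ∣ c)

  unit-small : ∀ c → 0 < c → c < p → Unit (+ c)
  unit-small c 0<c c<p p∣c = ℕP.<⇒≱ c<p (ND.∣⇒≤ ⦃ ℕ.>-nonZero 0<c ⦄ (∣⇒∣ᵤ p∣c))

  euclid : ∀ a b → P ∣ a * b → (P ∣ a) ⊎ (P ∣ b)
  euclid a b p∣ab with euclidsLemma ∣ a ∣ ∣ b ∣ isPrime (subst (p ND.∣_) (ℤP.abs-* a b) (∣⇒∣ᵤ p∣ab))
  ... | inj₁ p∣a = inj₁ (∣ᵤ⇒∣ p∣a)
  ... | inj₂ p∣b = inj₂ (∣ᵤ⇒∣ p∣b)

  unit-* : ∀ {a b} → Unit a → Unit b → Unit (a * b)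
  unit-* unit-a unit-b p∣ab = [ unit-a , unit-b ]′ (euclid _ _ p∣ab)

  unit-neg : ∀ {a} → Unit a → Unit (- a)
  unit-neg {a} unit-a p∣-a = unit-a (subst (P ∣_) (ℤP.neg-involutive a) (∣m⇒∣-m p∣-a))

  unit-one : Unit 1ℤ
  unit-one = unit-small 1 (s≤s z≤n) (ℕ.nonTrivial⇒n>1 p ⦃ prime⇒nonTrivial isPrime ⦄)

  unit-Π : ∀ k f → (∀ j → 1 ≤ j → j ≤ k → Unit (f j)) → Unit (Π k f)
  unit-Π zero    f units = unit-one
  unit-Π (suc k) f units = unit-* (unit-Π k f (λ j 1≤j j≤k → units j 1≤j (ℕP.m≤n⇒m≤1+n j≤k)))
                                  (units (suc k) (s≤s z≤n) ℕP.≤-refl)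

  cancel : ∀ {c x} → Unit c → P ∣ c * x → P ∣ x
  cancel {c} {x} unit-c p∣cx = [ (λ p∣c → contradiction p∣c unit-c) , id ]′ (euclid c x p∣cx)

  -- If p ∤ c and p^k ∣ c x then p^k ∣ x: Euclid gives x = q p, and p^{k-1} ∣ c q.
  cancel-power : ∀ k {c x} → Unit c → P ^ k ∣ c * x → P ^ k ∣ x
  cancel-power zero    {x = x} _ _ = divides x (sym (ℤP.*-identityʳ x))
  cancel-power (suc k) {c} {x} unit-c pᵏ⁺¹∣cx with cancel unit-c (∣-trans (∣m⇒∣m*n (P ^ k) ∣-refl) pᵏ⁺¹∣cx)
  ... | divides q refl = subst (_∣ q * P) (ℤP.*-comm (P ^ k) P) (*-monoˡ-∣ P (cancel-power k unit-c pᵏ∣cq))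
    where
      pᵏ∣cq : P ^ k ∣ c * q
      pᵏ∣cq = *-cancelʳ-∣ P (subst₂ _∣_ (ℤP.*-comm P (P ^ k)) (sym (ℤP.*-assoc c q P)) pᵏ⁺¹∣cx)

  cancel-mod : ∀ {c a b} → Unit c → c * a ≡ c * b mod P → a ≡ b mod P
  cancel-mod {c} {a} {b} unit-c (modular d) = modular (cancel unit-c (subst (P ∣_) (factor c a b) d))
    where factor : ∀ c a b → c * a - c * b ≡ c * (a - b)
          factor = solve-∀

  cancel-mod-power : ∀ k {c a b} → Unit c → c * a ≡ c * b mod P ^ k → a ≡ b mod P ^ k
  cancel-mod-power k {c} {a} {b} unit-c (modular d) = modular (cancel-power k unit-c (subst (P ^ k ∣_) (factor c a b) d))
    where factor : ∀ c a b → c * a - c * b ≡ c * (a - b)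
          factor = solve-∀

-- Writing w_i = n!/i and t_i = m!/i, this part shows  Σ_{i≤m} t_i² ≡ 0 (mod p)
-- (the sum of 1/i² over half the residues vanishes), and deduces that a
-- perturbation of order p² of the factors of  Π_{j≤m} λ j²  is invisible modulo p³.
module InverseSquares (m : ℕ) (isPrime : Prime (suc (m ℕ.+ m))) (2≤m : 2 ≤ m) where
  open ModuloPrime isPrime public

  n : ℕ
  n = m ℕ.+ m

  p : ℕ
  p = suc n

  m≤n : m ≤ n
  m≤n = ℕP.m≤m+n m m

  unit-range : ∀ c → 1 ≤ c → c ≤ n → Unit (+ c)
  unit-range c 1≤c c≤n = unit-small c 1≤c (s≤s c≤n)

  unit-two : Unit (+ 2)
  unit-two = unit-range 2 (s≤s z≤n) (ℕP.≤-trans 2≤m m≤n)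

  unit-three : Unit (+ 3)
  unit-three = unit-range 3 (s≤s z≤n) (ℕP.+-mono-≤ {1} {m} {2} {m} (ℕP.≤-trans (s≤s z≤n) 2≤m) 2≤m)

  unit-four : Unit (+ 4)
  unit-four = unit-range 4 (s≤s z≤n) (ℕP.+-mono-≤ {2} {m} {2} {m} 2≤m 2≤m)

  unit-factorial : ∀ k → k ≤ n → Unit (factorial k)
  unit-factorial k k≤n = unit-Π k (λ j → + j) (λ j 1≤j j≤k → unit-range j 1≤j (ℕP.≤-trans j≤k k≤n))

  unit-n! : Unit (factorial n)
  unit-n! = unit-factorial n ℕP.≤-refl

  unit-m! : Unit (factorial m)
  unit-m! = unit-factorial m m≤n

  P+x≡x : ∀ x → P + x ≡ x mod P
  P+x≡x x = modular (divides 1ℤ (difference P x))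
    where difference : ∀ y x → y + x - x ≡ 1ℤ * y
          difference = solve-∀

  w : ℕ → ℤ
  w = coFactorial n

  -- Modulo p, w_i behaves like 1/i:  c j ≡ i  implies  c w_i ≡ w_j.
  w-scaling : ∀ c i j → 1 ≤ i → i ≤ n → 1 ≤ j → j ≤ n → c * + j ≡ + i mod P → c * w i ≡ w j mod P
  w-scaling c i j 1≤i i≤n 1≤j j≤n cj≡i = cancel-mod (unit-range i 1≤i i≤n) (begin
    + i * (c * w i)     ≡⟨ rearrange (+ i) c (w i) ⟩
    c * (w i * + i)     ≡⟨ cong (c *_) (trans (coFactorial-restore n i 1≤i i≤n) (sym (coFactorial-restore n j 1≤j j≤n))) ⟩
    c * (w j * + j)     ≡⟨ rearrange′ c (w j) (+ j) ⟩
    (c * + j) * w j     ≈⟨ *-cong-mod cj≡i ≡-mod-refl ⟩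
    + i * w j           ∎)
    where
      open ≡-mod-Reasoning P
      rearrange : ∀ i c w → i * (c * w) ≡ c * (w * i)
      rearrange = solve-∀
      rearrange′ : ∀ c w j → c * (w * j) ≡ (c * j) * w
      rearrange′ = solve-∀

  -- 2 w_{2i} ≡ w_i  and  2 w_{2i-1} ≡ w_{m+i}, since 2(m+i) = p + (2i-1).
  w-even : ∀ i → 1 ≤ i → i ≤ m → + 2 * w (i ℕ.+ i) ≡ w i mod P
  w-even i 1≤i i≤m = w-scaling (+ 2) (i ℕ.+ i) i (ℕP.≤-trans 1≤i (ℕP.m≤m+n i i)) (ℕP.+-mono-≤ i≤m i≤m)
                       1≤i (ℕP.≤-trans i≤m m≤n) (≡-mod-reflexive (sym (pos-double i)))

  w-odd : ∀ i → 1 ≤ i → i ≤ m → + 2 * w (pred (i ℕ.+ i)) ≡ w (m ℕ.+ i) mod P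
  w-odd (suc i) _ i+1≤m = w-scaling (+ 2) o (m ℕ.+ suc i) 1≤o o≤n 1≤m+i m+i≤n (begin
    + 2 * + (m ℕ.+ suc i)                 ≡⟨ pos-double (m ℕ.+ suc i) ⟨
    + ((m ℕ.+ suc i) ℕ.+ (m ℕ.+ suc i))   ≡⟨ cong +_ (split m i) ⟩
    + (suc n ℕ.+ o)                       ≡⟨ ℤP.pos-+ (suc n) o ⟩
    P + + o                               ≈⟨ P+x≡x (+ o) ⟩
    + o                                   ∎)
    where
      open ≡-mod-Reasoning P
      o = i ℕ.+ suc i
      1≤o : 1 ≤ o
      1≤o = ℕP.≤-trans (s≤s z≤n) (ℕP.m≤n+m (suc i) i)
      o≤n : o ≤ n
      o≤n = ℕP.+-mono-≤ (ℕP.≤-trans (ℕP.n≤1+n i) i+1≤m) i+1≤m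
      1≤m+i : 1 ≤ m ℕ.+ suc i
      1≤m+i = ℕP.≤-trans (s≤s z≤n) (ℕP.m≤n+m (suc i) m)
      m+i≤n : m ℕ.+ suc i ≤ n
      m+i≤n = ℕP.+-monoʳ-≤ m i+1≤m
      split : ∀ m i → (m ℕ.+ suc i) ℕ.+ (m ℕ.+ suc i) ≡ suc (m ℕ.+ m) ℕ.+ (i ℕ.+ suc i)
      split = ℕSolver.solve-∀

  w-reflect : ∀ i → 1 ≤ i → i ≤ n → - 1ℤ * w i ≡ w (p ∸ i) mod P
  w-reflect i 1≤i i≤n = w-scaling (- 1ℤ) i (p ∸ i) 1≤i i≤n (ℕP.m<n⇒0<n∸m (s≤s i≤n)) (ℕP.∸-monoʳ-≤ p 1≤i) (begin
    - 1ℤ * + (p ∸ i)   ≡⟨ cong (- 1ℤ *_) (pos-∸ (ℕP.m≤n⇒m≤1+n i≤n)) ⟩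
    - 1ℤ * (P - + i)       ≡⟨ reflect P (+ i) ⟩
    - 1ℤ * P + + i         ≈⟨ +-congʳ-mod (+ i) (multiple≡0-mod (- 1ℤ)) ⟩
    0ℤ + + i               ≡⟨ ℤP.+-identityˡ (+ i) ⟩
    + i                    ∎)
    where
      open ≡-mod-Reasoning P
      reflect : ∀ y i → - 1ℤ * (y - i) ≡ - 1ℤ * y + i
      reflect = solve-∀

  w² : ℕ → ℤ
  w² i = w i * w i

  four-squares : ∀ a b → + 4 * (a * a + b * b) ≡ (+ 2 * a) * (+ 2 * a) + (+ 2 * b) * (+ 2 * b)
  four-squares = solve-∀

  -- Grouping the indices in pairs (2i-1, 2i) shows  4 Σ_{i≤n} w_i² ≡ Σ_{i≤n} w_i².
  four-squareSum : + 4 * Σ n w² ≡ Σ n w² mod P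
  four-squareSum = begin
    + 4 * Σ n w²                                         ≡⟨ cong (+ 4 *_) (Sum.big-odd-even m w²) ⟩
    + 4 * Σ m (λ i → w² (pred (i ℕ.+ i)) + w² (i ℕ.+ i))  ≡⟨ Σ-scale m (+ 4) _ ⟨
    Σ m (λ i → + 4 * (w² (pred (i ℕ.+ i)) + w² (i ℕ.+ i))) ≈⟨ Σ-cong-mod m pair ⟩
    Σ m (λ i → w² (m ℕ.+ i) + w² i)                       ≡⟨ Sum.big-distrib m (λ i → w² (m ℕ.+ i)) w² ⟩
    Σ m (λ i → w² (m ℕ.+ i)) + Σ m w²                     ≡⟨ ℤP.+-comm _ (Σ m w²) ⟩
    Σ m w² + Σ m (λ i → w² (m ℕ.+ i))                     ≡⟨ Sum.big-split m m w² ⟨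
    Σ n w²                                               ∎
    where
      open ≡-mod-Reasoning P
      pair : ∀ i → 1 ≤ i → i ≤ m → + 4 * (w² (pred (i ℕ.+ i)) + w² (i ℕ.+ i)) ≡ w² (m ℕ.+ i) + w² i mod P
      pair i 1≤i i≤m = begin
        + 4 * (w² (pred (i ℕ.+ i)) + w² (i ℕ.+ i))
          ≡⟨ four-squares (w (pred (i ℕ.+ i))) (w (i ℕ.+ i)) ⟩
        (+ 2 * w (pred (i ℕ.+ i))) * (+ 2 * w (pred (i ℕ.+ i))) + (+ 2 * w (i ℕ.+ i)) * (+ 2 * w (i ℕ.+ i))
          ≈⟨ +-cong-mod (*-cong-mod odd odd) (*-cong-mod even even) ⟩
        w² (m ℕ.+ i) + w² i ∎
        where odd = w-odd i 1≤i i≤m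
              even = w-even i 1≤i i≤m

  squareSum-divisible : P ∣ Σ n w²
  squareSum-divisible = cancel unit-three (subst (P ∣_) (three-times (Σ n w²)) (divides-difference four-squareSum))
    where
      three-times : ∀ z → + 4 * z - z ≡ + 3 * z
      three-times = solve-∀

  -- By the reflection, Σ_{i≤n} w_i² ≡ 2 Σ_{i≤m} w_i², so p ∣ Σ_{i≤m} w_i².
  halfSquareSum-divisible : P ∣ Σ m w²
  halfSquareSum-divisible = cancel unit-two (≡0-mod⇒∣ (begin
    + 2 * Σ m w²                          ≡⟨ Σ-scale m (+ 2) w² ⟨
    Σ m (λ i → + 2 * w² i)                ≈⟨ Σ-cong-mod m reflected ⟩
    Σ m (λ i → w² i + w² (p ∸ i))      ≡⟨ Sum.big-pairs m w² ⟨
    Σ n w²                                ≈⟨ ∣⇒≡0-mod squareSum-divisible ⟩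
    0ℤ                                    ∎))
    where
      open ≡-mod-Reasoning P
      reflected : ∀ i → 1 ≤ i → i ≤ m → + 2 * w² i ≡ w² i + w² (p ∸ i) mod P
      reflected i 1≤i i≤m = begin
        + 2 * w² i                              ≡⟨ doubled (w i) ⟩
        w² i + (- 1ℤ * w i) * (- 1ℤ * w i)      ≈⟨ +-congˡ-mod (w² i) (*-cong-mod reflect reflect) ⟩
        w² i + w² (p ∸ i)                   ∎
        where reflect = w-reflect i 1≤i (ℕP.≤-trans i≤m m≤n)
              doubled : ∀ x → + 2 * (x * x) ≡ x * x + (- 1ℤ * x) * (- 1ℤ * x)
              doubled = solve-∀

  t : ℕ → ℤ
  t = coFactorial m

  cancel-index : ∀ {x y} i → 1 ≤ i → x * + i ≡ y * + i → x ≡ y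
  cancel-index {x} {y} (suc i) _ = ℤP.*-cancelʳ-≡ x y (+ suc i)

  t-w : ∀ i → 1 ≤ i → i ≤ m → t i * factorial n ≡ factorial m * w i
  t-w i 1≤i i≤m = cancel-index i 1≤i (begin
    t i * factorial n * + i         ≡⟨ swap (t i) (factorial n) (+ i) ⟩
    t i * + i * factorial n         ≡⟨ cong (_* factorial n) (coFactorial-restore m i 1≤i i≤m) ⟩
    factorial m * factorial n       ≡⟨ cong (factorial m *_) (coFactorial-restore n i 1≤i (ℕP.≤-trans i≤m m≤n)) ⟨
    factorial m * (w i * + i)       ≡⟨ ℤP.*-assoc (factorial m) (w i) (+ i) ⟨
    factorial m * w i * + i         ∎)
    where open ≡-Reasoning
          swap : ∀ a b c → a * b * c ≡ a * c * b
          swap = solve-∀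

  -- Σ_{i≤m} (m!/i)² ≡ 0 (mod p), since n!² Σ t_i² = m!² Σ_{i≤m} w_i².
  tSquareSum-divisible : P ∣ Σ m (λ i → t i * t i)
  tSquareSum-divisible = cancel (unit-* unit-n! unit-n!)
    (subst (P ∣_) (sym rescale) (∣n⇒∣m*n (factorial m * factorial m) halfSquareSum-divisible))
    where
      square : ∀ F x → F * F * (x * x) ≡ (x * F) * (x * F)
      square = solve-∀
      square′ : ∀ F y → (F * y) * (F * y) ≡ F * F * (y * y)
      square′ = solve-∀
      termwise : ∀ i → 1 ≤ i → i ≤ m → factorial n * factorial n * (t i * t i) ≡ factorial m * factorial m * w² i
      termwise i 1≤i i≤m = trans (square (factorial n) (t i))
                                 (trans (cong₂ _*_ (t-w i 1≤i i≤m) (t-w i 1≤i i≤m)) (square′ (factorial m) (w i)))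
      rescale : factorial n * factorial n * Σ m (λ i → t i * t i) ≡ factorial m * factorial m * Σ m w²
      rescale = begin
        factorial n * factorial n * Σ m (λ i → t i * t i)           ≡⟨ Σ-scale m (factorial n * factorial n) _ ⟨
        Σ m (λ i → factorial n * factorial n * (t i * t i))         ≡⟨ Sum.big-cong m termwise ⟩
        Σ m (λ i → factorial m * factorial m * w² i)                ≡⟨ Σ-scale m (factorial m * factorial m) w² ⟩
        factorial m * factorial m * Σ m w²                          ∎
        where open ≡-Reasoning

  -- If a_j ≡ κ j² (mod p) with p ∤ κ, then p divides Σ_{i≤m} Π_{j≠i} a_j:
  -- κ m!² Π_{j≠i} a_j ≡ (m!/i)² Π_j a_j, and the t_i² sum to 0.
  omitted-products-vanish : ∀ a κ → Unit κ → (∀ j → 1 ≤ j → j ≤ m → a j ≡ κ * (+ j * + j) mod P) →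
                            P ∣ Σ m (λ i → Π-without m i a)
  omitted-products-vanish a κ unit-κ a≡κj² = cancel unit-κm!² (≡0-mod⇒∣ (begin
    κm!² * Σ m (λ i → Π-without m i a)       ≡⟨ Σ-scale m κm!² _ ⟨
    Σ m (λ i → κm!² * Π-without m i a)       ≈⟨ Σ-cong-mod m termwise ⟩
    Σ m (λ i → Π m a * (t i * t i))           ≡⟨ Σ-scale m (Π m a) _ ⟩
    Π m a * Σ m (λ i → t i * t i)             ≈⟨ *-congˡ-mod (Π m a) (∣⇒≡0-mod tSquareSum-divisible) ⟩
    Π m a * 0ℤ                               ≡⟨ ℤP.*-zeroʳ (Π m a) ⟩
    0ℤ                                       ∎))
    where
      open ≡-mod-Reasoning P
      κm!² = κ * (factorial m * factorial m)
      unit-κm!² = unit-* unit-κ (unit-* unit-m! unit-m!)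
      regroup : ∀ κ T I E → κ * ((T * I) * (T * I)) * E ≡ (E * (κ * (I * I))) * (T * T)
      regroup = solve-∀
      termwise : ∀ i → 1 ≤ i → i ≤ m → κm!² * Π-without m i a ≡ Π m a * (t i * t i) mod P
      termwise i 1≤i i≤m = begin
        κ * (factorial m * factorial m) * Π-without m i a
          ≡⟨ cong (λ F → κ * (F * F) * Π-without m i a) (coFactorial-restore m i 1≤i i≤m) ⟨
        κ * ((t i * + i) * (t i * + i)) * Π-without m i a
          ≡⟨ regroup κ (t i) (+ i) (Π-without m i a) ⟩
        (Π-without m i a * (κ * (+ i * + i))) * (t i * t i)
          ≈⟨ *-cong-mod (*-congˡ-mod (Π-without m i a) (≡-mod-sym (a≡κj² i 1≤i i≤m))) ≡-mod-refl ⟩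
        (Π-without m i a * a i) * (t i * t i)
          ≡⟨ cong (_* (t i * t i)) (Π-without-restore m i a 1≤i i≤m) ⟩
        Π m a * (t i * t i) ∎

  p³∣p²p² : P ^ 3 ∣ (P * P) * (P * P)
  p³∣p²p² = divides P (regroup P)
    where regroup : ∀ x → (x * x) * (x * x) ≡ x * (x * (x * (x * 1ℤ)))
          regroup = solve-∀

  Π-perturbation : ∀ a c κ → Unit κ → (∀ j → 1 ≤ j → j ≤ m → a j ≡ κ * (+ j * + j) mod P) →
                   Π m (λ j → a j + P * P * c) ≡ Π m a mod P ^ 3
  Π-perturbation a c κ unit-κ a≡κj² = begin
    Π m (λ j → a j + P * P * c)                      ≈⟨ ≡-mod-divisor p³∣p²p² (Π-expansion m a (λ _ → c) (P * P)) ⟩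
    Π m a + P * P * firstOrder m a (λ _ → c)         ≈⟨ +-congˡ-mod (Π m a) (∣⇒≡0-mod p³∣correction) ⟩
    Π m a + 0ℤ                                       ≡⟨ ℤP.+-identityʳ (Π m a) ⟩
    Π m a                                            ∎
    where
      open ≡-mod-Reasoning (P ^ 3)
      p∣firstOrder : P ∣ firstOrder m a (λ _ → c)
      p∣firstOrder = subst (P ∣_) (sym (Σ-scale m c (λ i → Π-without m i a)))
                           (∣n⇒∣m*n c (omitted-products-vanish a κ unit-κ a≡κj²))
      p³∣correction : P ^ 3 ∣ P * P * firstOrder m a (λ _ → c)
      p³∣correction = subst (_∣ P * P * firstOrder m a (λ _ → c)) cube-P (*-monoʳ-∣ (P * P) p∣firstOrder)

module CentralBinomial (m : ℕ) (isPrime : Prime (suc (m ℕ.+ m))) (2≤m : 2 ≤ m) where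
  open InverseSquares m isPrime 2≤m public

  p-i : ∀ i → i ≤ m → + (p ∸ i) ≡ P - + i
  p-i i i≤m = pos-∸ (ℕP.m≤n⇒m≤1+n (ℕP.≤-trans i≤m m≤n))

  shiftedFactorial : binom (p ℕ.+ n) n * factorial n ≡ Π n (λ j → + (p ℕ.+ j))
  shiftedFactorial = trans (binom-falling (p ℕ.+ n) n (ℕP.m≤n+m n p))
                           (Product.big-ext n (λ j → cong (λ x → + (x ℕ.+ j)) (ℕP.m+n∸n≡m p n)))

  -- Pairing j with p - j:  (p+i)(2p-i) = i(p-i) + 2p².
  shiftedFactorial-pairs : Π n (λ j → + (p ℕ.+ j)) ≡ Π m (λ i → + i * + (p ∸ i) + P * P * + 2)
  shiftedFactorial-pairs = trans (Product.big-pairs m _) (Product.big-cong m pair)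
    where
      expand : ∀ y i → (y + i) * (y + (y - i)) ≡ i * (y - i) + y * y * + 2
      expand = solve-∀
      pair : ∀ i → 1 ≤ i → i ≤ m → + (p ℕ.+ i) * + (p ℕ.+ (p ∸ i)) ≡ + i * + (p ∸ i) + P * P * + 2
      pair i _ i≤m = begin
        + (p ℕ.+ i) * + (p ℕ.+ (p ∸ i))       ≡⟨ cong₂ _*_ (ℤP.pos-+ p i) (ℤP.pos-+ p (p ∸ i)) ⟩
        (P + + i) * (P + + (p ∸ i))           ≡⟨ cong (λ x → (P + + i) * (P + x)) (p-i i i≤m) ⟩
        (P + + i) * (P + (P - + i))           ≡⟨ expand P (+ i) ⟩
        + i * (P - + i) + P * P * + 2         ≡⟨ cong (λ x → + i * x + P * P * + 2) (p-i i i≤m) ⟨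
        + i * + (p ∸ i) + P * P * + 2         ∎
        where open ≡-Reasoning

  complement-product : ∀ j → 1 ≤ j → j ≤ m → + j * + (p ∸ j) ≡ - 1ℤ * (+ j * + j) mod P
  complement-product j _ j≤m = modular (divides (+ j) (begin
    + j * + (p ∸ j) - - 1ℤ * (+ j * + j) ≡⟨ cong (λ x → + j * x - - 1ℤ * (+ j * + j)) (p-i j j≤m) ⟩
    + j * (P - + j) - - 1ℤ * (+ j * + j) ≡⟨ expand P (+ j) ⟩
    + j * P                              ∎))
    where open ≡-Reasoning
          expand : ∀ y j → j * (y - j) - - 1ℤ * (j * j) ≡ j * y
          expand = solve-∀

  wolstenholme : binom (p ℕ.+ n) n ≡ 1ℤ mod P ^ 3
  wolstenholme = cancel-mod-power 3 unit-n! (begin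
    factorial n * binom (p ℕ.+ n) n                  ≡⟨ ℤP.*-comm (factorial n) _ ⟩
    binom (p ℕ.+ n) n * factorial n                  ≡⟨ trans shiftedFactorial shiftedFactorial-pairs ⟩
    Π m (λ i → + i * + (p ∸ i) + P * P * + 2)
      ≈⟨ Π-perturbation (λ i → + i * + (p ∸ i)) (+ 2) (- 1ℤ) unit-minus-one complement-product ⟩
    Π m (λ i → + i * + (p ∸ i))                      ≡⟨ Product.big-pairs m (λ j → + j) ⟨
    factorial n                                      ≡⟨ ℤP.*-identityʳ (factorial n) ⟨
    factorial n * 1ℤ                                 ∎)
    where
      open ≡-mod-Reasoning (P ^ 3)
      unit-minus-one = unit-neg unit-one

  -- With Q = (m+1)⋯(2m), the odd
  -- products O₋ = Π (p - 2i) = 1·3⋯(2m-1) and O₊ = Π (p + 2i) satisfy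
  --   Q ≡ 2^m O₋,  m! C(2p-1,p-1) = 2^m O₊,  O₋ O₊ ≡ (-4)^m m!²  (mod p³),
  -- and Wolstenholme removes C(2p-1,p-1).
  upperHalf : ℤ
  upperHalf = Π m (λ j → + (m ℕ.+ j))

  oddMinus oddPlus : ℤ
  oddMinus = Π m (λ i → P - + 2 * + i)
  oddPlus  = Π m (λ i → P + + 2 * + i)

  unit-upperHalf : Unit upperHalf
  unit-upperHalf = unit-Π m _ (λ j 1≤j j≤m → unit-range (m ℕ.+ j) (ℕP.≤-trans 1≤j (ℕP.m≤n+m j m))
                                                                 (ℕP.+-monoʳ-≤ m j≤m))

  factorial-halves : factorial n ≡ factorial m * upperHalf
  factorial-halves = Product.big-split m m (λ j → + j)

  central-upperHalf : binom n m * factorial m ≡ upperHalf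
  central-upperHalf = trans (binom-falling n m m≤n)
                            (Product.big-ext m (λ j → cong (λ x → + (x ℕ.+ j)) (ℕP.m+n∸n≡m m m)))

  -- n! = (1·3⋯(2m-1)) · 2^m m!, and 1·3⋯(2m-1) = (p-2m)⋯(p-2) read backwards.
  factorial-parity : factorial n ≡ oddMinus * ((+ 2) ^ m * factorial m)
  factorial-parity = begin
    factorial n                                                   ≡⟨ Product.big-odd-even m (λ j → + j) ⟩
    Π m (λ i → + pred (i ℕ.+ i) * + (i ℕ.+ i))                    ≡⟨ Product.big-distrib m _ _ ⟩
    Π m (λ i → + pred (i ℕ.+ i)) * Π m (λ i → + (i ℕ.+ i))         ≡⟨ cong₂ _*_ odd-reversed (Product.big-ext m pos-double) ⟩
    oddMinus * Π m (λ i → + 2 * + i)                              ≡⟨ cong (oddMinus *_) (Π-scale m (+ 2) (λ i → + i)) ⟩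
    oddMinus * ((+ 2) ^ m * factorial m)                          ∎
    where
      open ≡-Reasoning
      reflected-odd : ∀ i → 1 ≤ i → i ≤ m → + pred ((suc m ∸ i) ℕ.+ (suc m ∸ i)) ≡ P - + 2 * + i
      reflected-odd i _ i≤m = begin
        + pred ((suc m ∸ i) ℕ.+ (suc m ∸ i)) ≡⟨ cong (λ k → + pred (k ℕ.+ k)) (ℕP.+-∸-assoc 1 i≤m) ⟩
        + (k ℕ.+ suc k)                      ≡⟨ pos-cancel (k ℕ.+ suc k) (i ℕ.+ i) p sums-to-p ⟩
        P - + (i ℕ.+ i)                      ≡⟨ cong (λ x → P - x) (pos-double i) ⟩
        P - + 2 * + i                        ∎
        where
          k = m ∸ i
          regroup : ∀ k i → (k ℕ.+ suc k) ℕ.+ (i ℕ.+ i) ≡ suc ((k ℕ.+ i) ℕ.+ (k ℕ.+ i))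
          regroup = ℕSolver.solve-∀
          sums-to-p : (k ℕ.+ suc k) ℕ.+ (i ℕ.+ i) ≡ p
          sums-to-p = trans (regroup k i) (cong (λ x → suc (x ℕ.+ x)) (ℕP.m∸n+n≡m i≤m))
      odd-reversed : Π m (λ i → + pred (i ℕ.+ i)) ≡ oddMinus
      odd-reversed = trans (Product.big-reverse m _) (Product.big-cong m reflected-odd)

  -- (p+1)(p+2)⋯(p+n) = 2^m Q O₊, grouping p + (2i-1) = 2(m+i) with p + 2i.
  shiftedFactorial-parity : Π n (λ j → + (p ℕ.+ j)) ≡ ((+ 2) ^ m * upperHalf) * oddPlus
  shiftedFactorial-parity = begin
    Π n (λ j → + (p ℕ.+ j))                                            ≡⟨ Product.big-odd-even m _ ⟩
    Π m (λ i → + (p ℕ.+ pred (i ℕ.+ i)) * + (p ℕ.+ (i ℕ.+ i)))           ≡⟨ Product.big-cong m pair ⟩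
    Π m (λ i → (+ 2 * + (m ℕ.+ i)) * (P + + 2 * + i))                  ≡⟨ Product.big-distrib m _ _ ⟩
    Π m (λ i → + 2 * + (m ℕ.+ i)) * oddPlus                           ≡⟨ cong (_* oddPlus) (Π-scale m (+ 2) (λ i → + (m ℕ.+ i))) ⟩
    ((+ 2) ^ m * upperHalf) * oddPlus                                 ∎
    where
      open ≡-Reasoning
      regroup : ∀ m i → suc (m ℕ.+ m) ℕ.+ (i ℕ.+ suc i) ≡ (m ℕ.+ suc i) ℕ.+ (m ℕ.+ suc i)
      regroup = ℕSolver.solve-∀
      pair : ∀ i → 1 ≤ i → i ≤ m → + (p ℕ.+ pred (i ℕ.+ i)) * + (p ℕ.+ (i ℕ.+ i)) ≡ (+ 2 * + (m ℕ.+ i)) * (P + + 2 * + i)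
      pair (suc i) _ _ = cong₂ _*_ (trans (cong +_ (regroup m i)) (pos-double (m ℕ.+ suc i)))
                                   (trans (ℤP.pos-+ p (suc i ℕ.+ suc i)) (cong (λ x → P + x) (pos-double (suc i))))

  -- (p - 2i)(p + 2i) = -4 i² + p², a perturbation of -4 i² by p².
  oddMinus-oddPlus : oddMinus * oddPlus ≡ (- + 4) ^ m * (factorial m * factorial m) mod P ^ 3
  oddMinus-oddPlus = begin
    oddMinus * oddPlus                                  ≡⟨ Product.big-distrib m _ _ ⟨
    Π m (λ i → (P - + 2 * + i) * (P + + 2 * + i))       ≡⟨ Product.big-ext m (λ i → difference-of-squares P (+ i)) ⟩
    Π m (λ i → - + 4 * (+ i * + i) + P * P * 1ℤ)
      ≈⟨ Π-perturbation (λ i → - + 4 * (+ i * + i)) 1ℤ (- + 4) unit-minus-four (λ _ _ _ → ≡-mod-refl) ⟩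
    Π m (λ i → - + 4 * (+ i * + i))                     ≡⟨ Π-scale m (- + 4) _ ⟩
    (- + 4) ^ m * Π m (λ i → + i * + i)                 ≡⟨ cong ((- + 4) ^ m *_) (Product.big-distrib m (λ i → + i) (λ i → + i)) ⟩
    (- + 4) ^ m * (factorial m * factorial m)           ∎
    where
      open ≡-mod-Reasoning (P ^ 3)
      difference-of-squares : ∀ y i → (y - + 2 * i) * (y + + 2 * i) ≡ - + 4 * (i * i) + y * y * 1ℤ
      difference-of-squares = solve-∀
      unit-minus-four = unit-neg unit-four

  -- Cancelling Q from  Q (m! W) = W n! = 2^m Q O₊  where W = C(2p-1, p-1).
  factorial-times-W : factorial m * binom (p ℕ.+ n) n ≡ (+ 2) ^ m * oddPlus mod P ^ 3
  factorial-times-W = cancel-mod-power 3 unit-upperHalf (≡-mod-reflexive (begin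
    upperHalf * (factorial m * W)        ≡⟨ rearrange upperHalf (factorial m) W ⟩
    W * (factorial m * upperHalf)        ≡⟨ cong (W *_) factorial-halves ⟨
    W * factorial n                      ≡⟨ trans shiftedFactorial shiftedFactorial-parity ⟩
    ((+ 2) ^ m * upperHalf) * oddPlus     ≡⟨ rearrange′ ((+ 2) ^ m) upperHalf oddPlus ⟩
    upperHalf * ((+ 2) ^ m * oddPlus)     ∎))
    where
      open ≡-Reasoning
      W = binom (p ℕ.+ n) n
      rearrange : ∀ q f w → q * (f * w) ≡ w * (f * q)
      rearrange = solve-∀
      rearrange′ : ∀ a q o → a * q * o ≡ q * (a * o)
      rearrange′ = solve-∀

  -- Cancelling m! from  m! Q = n! = O₋ 2^m m!.
  upperHalf-oddMinus : upperHalf ≡ (+ 2) ^ m * oddMinus mod P ^ 3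
  upperHalf-oddMinus = cancel-mod-power 3 unit-m! (≡-mod-reflexive (begin
    factorial m * upperHalf               ≡⟨ factorial-halves ⟨
    factorial n                           ≡⟨ factorial-parity ⟩
    oddMinus * ((+ 2) ^ m * factorial m)  ≡⟨ rearrange (factorial m) ((+ 2) ^ m) oddMinus ⟩
    factorial m * ((+ 2) ^ m * oddMinus)  ∎))
    where
      open ≡-Reasoning
      rearrange : ∀ f a o → o * (a * f) ≡ f * (a * o)
      rearrange = solve-∀

  powers-of-four : sign m * ((+ 2) ^ m * (+ 2) ^ m) * (- + 4) ^ m ≡ (+ 4) ^ n
  powers-of-four = begin
    sign m * ((+ 2) ^ m * (+ 2) ^ m) * (- + 4) ^ m   ≡⟨ cong (λ x → sign m * x * (- + 4) ^ m) (^-distribʳ-* m (+ 2) (+ 2)) ⟨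
    sign m * (+ 4) ^ m * (- 1ℤ * + 4) ^ m           ≡⟨ cong (sign m * (+ 4) ^ m *_) (^-distribʳ-* m (- 1ℤ) (+ 4)) ⟩
    sign m * (+ 4) ^ m * (sign m * (+ 4) ^ m)       ≡⟨ regroup (sign m) ((+ 4) ^ m) ⟩
    (sign m * sign m) * ((+ 4) ^ m * (+ 4) ^ m)     ≡⟨ cong (_* ((+ 4) ^ m * (+ 4) ^ m)) (sign-square m) ⟩
    1ℤ * ((+ 4) ^ m * (+ 4) ^ m)                    ≡⟨ ℤP.*-identityˡ _ ⟩
    (+ 4) ^ m * (+ 4) ^ m                           ≡⟨ ℤP.^-distribˡ-+-* (+ 4) m m ⟨
    (+ 4) ^ n                                       ∎
    where
      open ≡-Reasoning
      regroup : ∀ s f → s * f * (s * f) ≡ (s * s) * (f * f)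
      regroup = solve-∀

  morley : sign m * binom n m ≡ (+ 4) ^ n mod P ^ 3
  morley = begin
    B                                                     ≡⟨ ℤP.*-identityʳ B ⟨
    B * 1ℤ                                                ≈⟨ *-congˡ-mod B (≡-mod-sym wolstenholme) ⟩
    B * W                                                 ≈⟨ cancel-mod-power 3 (unit-* unit-m! unit-m!) m!²BW ⟩
    (+ 4) ^ n                                             ∎
    where
      open ≡-mod-Reasoning (P ^ 3)
      B = sign m * binom n m
      W = binom (p ℕ.+ n) n
      s2ᵐ = sign m * ((+ 2) ^ m * (+ 2) ^ m)
      regroup : ∀ f b w → f * f * (b * w) ≡ b * f * (f * w)
      regroup = solve-∀
      regroup′ : ∀ s a x y → s * (a * x) * (a * y) ≡ s * (a * a) * (x * y)
      regroup′ = solve-∀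
      Bm! : B * factorial m ≡ sign m * ((+ 2) ^ m * oddMinus) mod P ^ 3
      Bm! = begin
        B * factorial m                  ≡⟨ ℤP.*-assoc (sign m) (binom n m) (factorial m) ⟩
        sign m * (binom n m * factorial m) ≡⟨ cong (sign m *_) central-upperHalf ⟩
        sign m * upperHalf               ≈⟨ *-congˡ-mod (sign m) upperHalf-oddMinus ⟩
        sign m * ((+ 2) ^ m * oddMinus)  ∎
      m!²BW : factorial m * factorial m * (B * W) ≡ factorial m * factorial m * (+ 4) ^ n mod P ^ 3
      m!²BW = begin
        factorial m * factorial m * (B * W)                          ≡⟨ regroup (factorial m) B W ⟩
        B * factorial m * (factorial m * W)                          ≈⟨ *-cong-mod Bm! factorial-times-W ⟩
        sign m * ((+ 2) ^ m * oddMinus) * ((+ 2) ^ m * oddPlus)      ≡⟨ regroup′ (sign m) ((+ 2) ^ m) oddMinus oddPlus ⟩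
        s2ᵐ * (oddMinus * oddPlus)                                   ≈⟨ *-congˡ-mod s2ᵐ oddMinus-oddPlus ⟩
        s2ᵐ * ((- + 4) ^ m * (factorial m * factorial m))            ≡⟨ ℤP.*-assoc s2ᵐ ((- + 4) ^ m) _ ⟨
        s2ᵐ * (- + 4) ^ m * (factorial m * factorial m)              ≡⟨ cong (_* (factorial m * factorial m)) powers-of-four ⟩
        (+ 4) ^ n * (factorial m * factorial m)                      ≡⟨ ℤP.*-comm ((+ 4) ^ n) _ ⟩
        factorial m * factorial m * (+ 4) ^ n                        ∎

module MainCongruence (m : ℕ) (isPrime : Prime (suc (m ℕ.+ m))) (2≤m : 2 ≤ m) where
  open CentralBinomial m isPrime 2≤m public

  x y u e : ℕ → ℤ
  x k = binom n k
  y k = binom n (k ∸ 1)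
  u k = binom p k
  e k = sign (k ∸ 1)

  u≡x+y : ∀ k → 1 ≤ k → u k ≡ x k + y k
  u≡x+y (suc k) _ = pascal n (suc k)

  -- p ∣ C(p,k) for 0 < k < p, because k C(p,k) = p C(p-1,k-1).
  p∣u : ∀ k → 1 ≤ k → k ≤ n → P ∣ u k
  p∣u (suc k) 1≤k k≤n = cancel (unit-range (suc k) 1≤k k≤n) (divides (binom n k) (begin
    + suc k * u (suc k)          ≡⟨ ℤP.pos-* (suc k) (p C suc k) ⟨
    + (suc k ℕ.* (p C suc k))    ≡⟨ cong +_ (absorption n k) ⟩
    + (p ℕ.* (n C k))            ≡⟨ ℤP.pos-* p (n C k) ⟩
    P * binom n k                ≡⟨ ℤP.*-comm P (binom n k) ⟩
    binom n k * P                ∎))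
    where open ≡-Reasoning

  -- Σ_{k=1}^{n} C(p,k) = 2^p - 2: the row sum without its two outer terms.
  u-sum : Σ n u ≡ (+ 2) ^ p - + 2
  u-sum = isolate (Σ n u) ((+ 2) ^ p) (begin
    (+ 2) ^ p                                            ≡⟨ binomial-row-sum p ⟨
    Σ₀ p (binom p)                                       ≡⟨ Σ₀-peel n (binom p) ⟩
    binom p 0 + (Σ n (λ k → u (suc (k ∸ 1))) + u p)
      ≡⟨ cong₂ (λ a b → a + (b + u p)) (cong +_ (nC0≡1 p)) (Sum.big-cong n shift-back) ⟩
    1ℤ + (Σ n u + u p)                                   ≡⟨ cong (λ a → 1ℤ + (Σ n u + a)) (cong +_ (nCn≡1 p)) ⟩
    1ℤ + (Σ n u + 1ℤ)                                    ∎)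
    where
      open ≡-Reasoning
      shift-back : ∀ k → 1 ≤ k → k ≤ n → u (suc (k ∸ 1)) ≡ u k
      shift-back (suc k) _ _ = refl
      isolate : ∀ s t → t ≡ 1ℤ + (s + 1ℤ) → s ≡ t - + 2
      isolate s t refl = rearrange s
        where rearrange : ∀ s → s ≡ 1ℤ + (s + 1ℤ) - + 2
              rearrange = solve-∀

  -- (-1)^j C(p-1,j) ≡ 1 (mod p), by induction with C(p-1,j+1) = C(p,j+1) - C(p-1,j).
  alternating-row : ∀ j → j < n → sign j * x j ≡ 1ℤ mod P
  alternating-row zero    _     = ≡-mod-reflexive (trans (ℤP.*-identityˡ (x 0)) (cong +_ (nC0≡1 n)))
  alternating-row (suc j) j+1<n = begin
    sign (suc j) * x (suc j)                   ≡⟨ step (sign j) (x (suc j)) (x j) (u (suc j)) (pascal n (suc j)) ⟩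
    sign j * x j + (- sign j) * u (suc j)      ≈⟨ +-cong-mod (alternating-row j (ℕP.<-trans (ℕP.n<1+n j) j+1<n))
                                                    (∣⇒≡0-mod (∣n⇒∣m*n (- sign j) (p∣u (suc j) (s≤s z≤n) (ℕP.<⇒≤ j+1<n)))) ⟩
    1ℤ + 0ℤ                                    ≡⟨⟩
    1ℤ                                         ∎
    where
      open ≡-mod-Reasoning P
      step : ∀ s a b c → c ≡ a + b → (- 1ℤ * s) * a ≡ s * b + (- s) * c
      step s a b c refl = rearrange s a b
        where rearrange : ∀ s a b → (- 1ℤ * s) * a ≡ s * b + (- s) * (a + b)
              rearrange = solve-∀

  e-y≡1 : ∀ k → 1 ≤ k → k ≤ n → e k * y k ≡ 1ℤ mod P
  e-y≡1 (suc k) _ k<n = alternating-row k k<n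

  sign-n : sign n ≡ 1ℤ
  sign-n = trans (sign-+ m m) (sign-square m)

  sign-complement : ∀ k → k ≤ n → sign (n ∸ k) ≡ sign k
  sign-complement k k≤n = begin
    sign (n ∸ k)                        ≡⟨ ℤP.*-identityʳ (sign (n ∸ k)) ⟨
    sign (n ∸ k) * 1ℤ                   ≡⟨ cong (sign (n ∸ k) *_) (sign-square k) ⟨
    sign (n ∸ k) * (sign k * sign k)    ≡⟨ ℤP.*-assoc (sign (n ∸ k)) (sign k) (sign k) ⟨
    sign (n ∸ k) * sign k * sign k      ≡⟨ cong (_* sign k) (sign-+ (n ∸ k) k) ⟨
    sign (n ∸ k ℕ.+ k) * sign k         ≡⟨ cong (λ j → sign j * sign k) (ℕP.m∸n+n≡m k≤n) ⟩
    sign n * sign k                     ≡⟨ cong (_* sign k) sign-n ⟩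
    1ℤ * sign k                         ≡⟨ ℤP.*-identityˡ (sign k) ⟩
    sign k                              ∎
    where open ≡-Reasoning

  reflect-index : ∀ k → (n ∸ k) ∸ 1 ≡ n ∸ suc k
  reflect-index k = trans (ℕP.∸-+-assoc n k 1) (cong (n ∸_) (ℕP.+-comm k 1))

  reflect-x : ∀ k → 1 ≤ k → k ≤ n → x (p ∸ k) ≡ y k
  reflect-x (suc k) _ k<n = binom-sym n k (ℕP.<⇒≤ k<n)

  reflect-y : ∀ k → 1 ≤ k → k ≤ n → y (p ∸ k) ≡ x k
  reflect-y (suc k) _ k<n = trans (cong (binom n) (reflect-index k)) (binom-sym n (suc k) k<n)

  reflect-e : ∀ k → 1 ≤ k → k ≤ n → e (p ∸ k) ≡ - e k
  reflect-e (suc k) _ k<n = trans (cong sign (reflect-index k)) (trans (sign-complement (suc k) k<n) (sign-suc k))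

  reflection : ∀ (F : ℤ → ℤ → ℤ → ℤ) → Σ n (λ k → F (e k) (x k) (y k)) ≡ Σ n (λ k → F (- e k) (y k) (x k))
  reflection F = trans (Sum.big-reverse n _) (Sum.big-cong n reflected)
    where
      reflected : ∀ k → 1 ≤ k → k ≤ n → F (e (p ∸ k)) (x (p ∸ k)) (y (p ∸ k)) ≡ F (- e k) (y k) (x k)
      reflected k 1≤k k≤n = trans (cong₂ (λ s a → F s a (y (p ∸ k))) (reflect-e k 1≤k k≤n) (reflect-x k 1≤k k≤n))
                                  (cong (F (- e k) (y k)) (reflect-y k 1≤k k≤n))

  S Y : ℤ
  S = Σ n (λ k → x k * (y k * y k))
  Y = Σ n (λ k → y k * (y k * y k))

  -- Σ e x y = 0, being equal to its own negative.
  mixed-vanishes : Σ n (λ k → e k * (x k * y k)) ≡ 0ℤ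
  mixed-vanishes = ℤP.*-cancelˡ-≡ (+ 2) _ 0ℤ (begin
    + 2 * X           ≡⟨ twice X ⟩
    X + X             ≡⟨ cong (λ z → X + z) antisymmetric ⟩
    X + - X           ≡⟨ ℤP.+-inverseʳ X ⟩
    0ℤ                ≡⟨ ℤP.*-zeroʳ (+ 2) ⟨
    + 2 * 0ℤ          ∎)
    where
      open ≡-Reasoning
      X = Σ n (λ k → e k * (x k * y k))
      twice : ∀ a → + 2 * a ≡ a + a
      twice = solve-∀
      flip : ∀ s a b → (- s) * (b * a) ≡ - (s * (a * b))
      flip = solve-∀
      antisymmetric : X ≡ - X
      antisymmetric = trans (reflection (λ s a b → s * (a * b))) (trans (Sum.big-ext n (λ k → flip (e k) (x k) (y k))) (Σ-neg n _))

  Σ-four : ∀ a b c d → Σ n (λ k → a k + b k + c k + d k) ≡ Σ n a + Σ n b + Σ n c + Σ n d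
  Σ-four a b c d = trans (Sum.big-distrib n _ d) (cong (_+ Σ n d)
                     (trans (Sum.big-distrib n _ c) (cong (_+ Σ n c) (Sum.big-distrib n a b))))

  -- Σ u³ = Σ (x + y)³ = Σ x³ + 3 Σ y x² + 3 Σ x y² + Σ y³ = 2Y + 6S, by the reflection.
  sum-of-cubes : Σ n (λ k → u k * u k * u k) ≡ + 2 * Y + + 6 * S
  sum-of-cubes = begin
    Σ n (λ k → u k * u k * u k)
      ≡⟨ Sum.big-cong n (λ k 1≤k _ → trans (cong (λ z → z * z * z) (u≡x+y k 1≤k)) (expand (x k) (y k))) ⟩
    Σ n (λ k → x k * (x k * x k) + + 3 * (y k * (x k * x k)) + + 3 * (x k * (y k * y k)) + y k * (y k * y k))
      ≡⟨ Σ-four _ _ _ _ ⟩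
    Σ n (λ k → x k * (x k * x k)) + Σ n (λ k → + 3 * (y k * (x k * x k))) + Σ n (λ k → + 3 * (x k * (y k * y k))) + Y
      ≡⟨ cong₂ (λ a b → a + b + Σ n (λ k → + 3 * (x k * (y k * y k))) + Y)
               (reflection (λ _ a _ → a * (a * a)))
               (trans (Σ-scale n (+ 3) _) (cong (+ 3 *_) (reflection (λ _ a b → b * (a * a))))) ⟩
    Y + + 3 * S + Σ n (λ k → + 3 * (x k * (y k * y k))) + Y
      ≡⟨ cong (λ a → Y + + 3 * S + a + Y) (Σ-scale n (+ 3) _) ⟩
    Y + + 3 * S + + 3 * S + Y
      ≡⟨ collect Y S ⟩
    + 2 * Y + + 6 * S ∎
    where
      open ≡-Reasoning
      expand : ∀ a b → (a + b) * (a + b) * (a + b) ≡ a * (a * a) + + 3 * (b * (a * a)) + + 3 * (a * (b * b)) + b * (b * b)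
      expand = solve-∀
      collect : ∀ Y S → Y + + 3 * S + + 3 * S + Y ≡ + 2 * Y + + 6 * S
      collect = solve-∀

  -- (1)  2Y + 6S ≡ 0 (mod p³), as p³ divides each u_k³.
  cubes-vanish : + 2 * Y + + 6 * S ≡ 0ℤ mod P ^ 3
  cubes-vanish = subst (_≡ 0ℤ mod P ^ 3) sum-of-cubes (∣⇒≡0-mod (Σ-∣ n p³∣u³))
    where
      p³∣u³ : ∀ k → 1 ≤ k → k ≤ n → P ^ 3 ∣ u k * u k * u k
      p³∣u³ k 1≤k k≤n = subst (_∣ u k * u k * u k) cube-P (*-mono-∣ (*-mono-∣ p∣uₖ p∣uₖ) p∣uₖ)
        where p∣uₖ = p∣u k 1≤k k≤n

  u-y²-sum : Σ n (λ k → u k * (y k * y k)) ≡ S + Y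
  u-y²-sum = trans (Sum.big-cong n split) (Sum.big-distrib n _ _)
    where split : ∀ k → 1 ≤ k → k ≤ n → u k * (y k * y k) ≡ x k * (y k * y k) + y k * (y k * y k)
          split k 1≤k _ = trans (cong (_* (y k * y k)) (u≡x+y k 1≤k)) (ℤP.*-distribʳ-+ (y k * y k) (x k) (y k))

  -- (3)  u y² ≡ 2 e u y - u (mod p³): u (e y - 1)² ≡ 0 because p ∣ u and p ∣ e y - 1.
  u-y² : ∀ k → 1 ≤ k → k ≤ n → u k * (y k * y k) ≡ + 2 * (e k * (u k * y k)) - u k mod P ^ 3
  u-y² k@(suc j) 1≤k k≤n = modular (subst (P ^ 3 ∣_) identity p³∣ud²)
    where
      d = e k * y k - 1ℤ
      p∣d : P ∣ d
      p∣d = divides-difference (e-y≡1 k 1≤k k≤n)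
      p³∣ud² : P ^ 3 ∣ u k * d * d
      p³∣ud² = subst (_∣ u k * d * d) cube-P (*-mono-∣ (*-mono-∣ (p∣u k 1≤k k≤n) p∣d) p∣d)
      expand : ∀ u y e → u * (e * y - 1ℤ) * (e * y - 1ℤ) ≡ (e * e) * (u * (y * y)) - (+ 2 * (e * (u * y)) - u)
      expand = solve-∀
      identity : u k * d * d ≡ u k * (y k * y k) - (+ 2 * (e k * (u k * y k)) - u k)
      identity = begin
        u k * d * d                          ≡⟨ expand (u k) (y k) (e k) ⟩
        (e k * e k) * (u k * (y k * y k)) - r ≡⟨ cong (λ z → z * (u k * (y k * y k)) - r) (sign-square j) ⟩
        1ℤ * (u k * (y k * y k)) - r          ≡⟨ cong (_- r) (ℤP.*-identityˡ (u k * (y k * y k))) ⟩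
        u k * (y k * y k) - r                 ∎
        where open ≡-Reasoning
              r = + 2 * (e k * (u k * y k)) - u k

  -- (4)  Σ e y² = Σ_{j<n} (-1)^j C(n,j)² = (-1)^m C(2m,m) - 1.
  signed-y²-sum : Σ n (λ k → e k * (y k * y k)) ≡ sign m * binom n m - 1ℤ
  signed-y²-sum = begin
    Σ n (λ k → e k * (y k * y k))           ≡⟨ Sum.big-cong n symmetric ⟩
    Σ n (λ k → term (k ∸ 1))                ≡⟨ add-sub _ ⟩
    Σ n (λ k → term (k ∸ 1)) + 1ℤ - 1ℤ      ≡⟨ cong (λ z → Σ n (λ k → term (k ∸ 1)) + z - 1ℤ) last ⟨
    alternating n n - 1ℤ                    ≡⟨ cong (_- 1ℤ) (AlternatingConvolution.even n m) ⟩
    sign m * binom n m - 1ℤ                 ∎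
    where
      open ≡-Reasoning
      term : ℕ → ℤ
      term j = sign j * (binom n j * binom n (n ∸ j))
      symmetric : ∀ k → 1 ≤ k → k ≤ n → e k * (y k * y k) ≡ term (k ∸ 1)
      symmetric k _ k≤n = cong (λ z → e k * (y k * z)) (sym (binom-sym n (k ∸ 1) (ℕP.≤-trans (ℕP.m∸n≤m k 1) k≤n)))
      last : term n ≡ 1ℤ
      last = begin
        sign n * (binom n n * binom n (n ∸ n)) ≡⟨ cong₂ (λ s z → s * (z * binom n (n ∸ n))) sign-n (cong +_ (nCn≡1 n)) ⟩
        1ℤ * (1ℤ * binom n (n ∸ n))            ≡⟨ cong (λ j → 1ℤ * (1ℤ * binom n j)) (ℕP.n∸n≡0 n) ⟩
        1ℤ * (1ℤ * binom n 0)                  ≡⟨ cong (λ z → 1ℤ * (1ℤ * + z)) (nC0≡1 n) ⟩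
        1ℤ                                     ∎
      add-sub : ∀ a → a ≡ a + 1ℤ - 1ℤ
      add-sub = solve-∀

  signed-u-y-sum : Σ n (λ k → e k * (u k * y k)) ≡ sign m * binom n m - 1ℤ
  signed-u-y-sum = begin
    Σ n (λ k → e k * (u k * y k))                                      ≡⟨ Sum.big-cong n split ⟩
    Σ n (λ k → e k * (x k * y k) + e k * (y k * y k))                  ≡⟨ Sum.big-distrib n _ _ ⟩
    Σ n (λ k → e k * (x k * y k)) + Σ n (λ k → e k * (y k * y k))      ≡⟨ cong₂ _+_ mixed-vanishes signed-y²-sum ⟩
    0ℤ + (sign m * binom n m - 1ℤ)                                     ≡⟨ ℤP.+-identityˡ _ ⟩
    sign m * binom n m - 1ℤ                                            ∎
    where
      open ≡-Reasoning
      distribute : ∀ e a b c → e * ((a + b) * c) ≡ e * (a * c) + e * (b * c)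
      distribute = solve-∀
      split : ∀ k → 1 ≤ k → k ≤ n → e k * (u k * y k) ≡ e k * (x k * y k) + e k * (y k * y k)
      split k 1≤k _ = trans (cong (λ z → e k * (z * y k)) (u≡x+y k 1≤k)) (distribute (e k) (x k) (y k) (y k))

  -- Summing (3), with (2) and (4):  S + Y ≡ 2((-1)^m C(2m,m) - 1) - (2^p - 2).
  S+Y : S + Y ≡ + 2 * (sign m * binom n m - 1ℤ) - ((+ 2) ^ p - + 2) mod P ^ 3
  S+Y = begin
    S + Y                                                    ≡⟨ u-y²-sum ⟨
    Σ n (λ k → u k * (y k * y k))                            ≈⟨ Σ-cong-mod n u-y² ⟩
    Σ n (λ k → + 2 * (e k * (u k * y k)) - u k)              ≡⟨ Sum.big-distrib n _ _ ⟩
    Σ n (λ k → + 2 * (e k * (u k * y k))) + Σ n (λ k → - u k) ≡⟨ cong₂ _+_ (Σ-scale n (+ 2) _) (Σ-neg n u) ⟩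
    + 2 * Σ n (λ k → e k * (u k * y k)) - Σ n u               ≡⟨ cong₂ (λ a b → + 2 * a - b) signed-u-y-sum u-sum ⟩
    + 2 * (sign m * binom n m - 1ℤ) - ((+ 2) ^ p - + 2)       ∎
    where open ≡-mod-Reasoning (P ^ 3)

  four^n : (+ 4) ^ n ≡ (+ 2) ^ (n ℕ.+ n)
  four^n = trans (^-distribʳ-* n (+ 2) (+ 2)) (sym (ℤP.^-distribˡ-+-* (+ 2) n n))

  -- 4S = (1) - 2·(2), then Morley.
  theorem : S ≡ (+ 2) ^ n - (+ 2) ^ (n ℕ.+ n) mod P ^ 3
  theorem = cancel-mod-power 3 unit-four (begin
    + 4 * S                                        ≡⟨ combine S Y ⟩
    (+ 2 * Y + + 6 * S) + - (+ 2 * (S + Y))        ≈⟨ +-cong-mod cubes-vanish (-‿cong-mod (*-congˡ-mod (+ 2) S+Y)) ⟩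
    0ℤ + - (+ 2 * (+ 2 * (B - 1ℤ) - (+ 2 * 2ⁿ - + 2))) ≡⟨ simplify B 2ⁿ ⟩
    + 4 * 2ⁿ + - (+ 4 * B)                         ≈⟨ +-congˡ-mod (+ 4 * 2ⁿ) (-‿cong-mod (*-congˡ-mod (+ 4) morley)) ⟩
    + 4 * 2ⁿ + - (+ 4 * (+ 4) ^ n)                 ≡⟨ cong (λ z → + 4 * 2ⁿ + - (+ 4 * z)) four^n ⟩
    + 4 * 2ⁿ + - (+ 4 * (+ 2) ^ (n ℕ.+ n))          ≡⟨ factor 2ⁿ ((+ 2) ^ (n ℕ.+ n)) ⟩
    + 4 * (2ⁿ - (+ 2) ^ (n ℕ.+ n))                  ∎)
    where
      open ≡-mod-Reasoning (P ^ 3)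
      B = sign m * binom n m
      2ⁿ = (+ 2) ^ n
      combine : ∀ S Y → + 4 * S ≡ (+ 2 * Y + + 6 * S) + - (+ 2 * (S + Y))
      combine = solve-∀
      simplify : ∀ B t → 0ℤ + - (+ 2 * (+ 2 * (B - 1ℤ) - (+ 2 * t - + 2))) ≡ + 4 * t + - (+ 4 * B)
      simplify = solve-∀
      factor : ∀ t s → + 4 * t + - (+ 4 * s) ≡ + 4 * (t - s)
      factor = solve-∀

parity : ∀ k → (∃ λ m → k ≡ m ℕ.+ m) ⊎ (∃ λ m → k ≡ suc (m ℕ.+ m))
parity zero    = inj₁ (0 , refl)
parity (suc k) with parity k
... | inj₁ (m , refl) = inj₂ (m , refl)
... | inj₂ (m , refl) = inj₁ (suc m , cong suc (sym (ℕP.+-suc m m)))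

odd-prime : ∀ m → Prime (m ℕ.+ m) → m ℕ.+ m > 3 → ⊥
odd-prime m isPrime 3<m+m with prime⇒irreducible isPrime (ND.divides m (m+m≡m*2 m))
  where m+m≡m*2 : ∀ m → m ℕ.+ m ≡ m ℕ.* 2
        m+m≡m*2 = ℕSolver.solve-∀
... | inj₁ ()
... | inj₂ 2≡m+m = ℕP.<-asym (subst (3 <_) (sym 2≡m+m) 3<m+m) (s≤s (s≤s (s≤s z≤n)))

half≥2 : ∀ m → 3 < suc (m ℕ.+ m) → 2 ≤ m
half≥2 zero          (s≤s ())
half≥2 (suc zero)    (s≤s (s≤s (s≤s ())))
half≥2 (suc (suc m)) _ = s≤s (s≤s z≤n)

sumFrom1-Σ : ∀ N f → + sumFrom1 N f ≡ Σ N (λ k → + f k)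
sumFrom1-Σ zero    f = refl
sumFrom1-Σ (suc N) f = trans (ℤP.pos-+ (sumFrom1 N f) (f (suc N)))
                             (cong (_+ + f (suc N)) (sumFrom1-Σ N f))

lhsSum-in-ℤ : ∀ n → + lhsSum (suc n) ≡ Σ n (λ k → binom n k * (binom n (k ∸ 1) * binom n (k ∸ 1)))
lhsSum-in-ℤ n = trans (sumFrom1-Σ n _) (Sum.big-ext n term)
  where
    term : ∀ k → + ((n C k) ℕ.* (n C (k ∸ 1)) ℕ.^ 2) ≡ binom n k * (binom n (k ∸ 1) * binom n (k ∸ 1))
    term k = begin
      + (c ℕ.* (d ℕ.* (d ℕ.* 1)))        ≡⟨ cong (λ z → + (c ℕ.* (d ℕ.* z))) (ℕP.*-identityʳ d) ⟩
      + (c ℕ.* (d ℕ.* d))                ≡⟨ ℤP.pos-* c (d ℕ.* d) ⟩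
      + c * + (d ℕ.* d)                  ≡⟨ cong (+ c *_) (ℤP.pos-* d d) ⟩
      + c * (+ d * + d)                  ∎
      where open ≡-Reasoning
            c = n C k
            d = n C (k ∸ 1)

exponent : ∀ n → 2 ℕ.* suc n ∸ 2 ≡ n ℕ.+ n
exponent n = cong (_∸ 2) (double-suc n)
  where double-suc : ∀ n → 2 ℕ.* suc n ≡ suc (suc (n ℕ.+ n))
        double-suc = ℕSolver.solve-∀

lemma3p2 : (p : ℕ) → Prime p → p > 3 →
    (+ p) ^ 3 ∣ᵤ (+ lhsSum p - ((+ 2) ^ (p ∸ 1) - (+ 2) ^ (2 ℕ.* p ∸ 2)))
lemma3p2 p isPrime p>3 with parity p
... | inj₁ (m , refl) = ⊥-elim (odd-prime m isPrime p>3)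
... | inj₂ (m , refl) = ∣⇒∣ᵤ (subst (P ^ 3 ∣_) same-difference (divides-difference theorem))
  where
    open MainCongruence m isPrime (half≥2 m p>3)
    same-difference : S - ((+ 2) ^ n - (+ 2) ^ (n ℕ.+ n)) ≡ + lhsSum (suc n) - ((+ 2) ^ n - (+ 2) ^ (2 ℕ.* suc n ∸ 2))
    same-difference = cong₂ _-_ (sym (lhsSum-in-ℤ n)) (cong (λ k → (+ 2) ^ n - (+ 2) ^ k) (sym (exponent n)))
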